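{- Let $\mathcal{B}=\{\mathbf{f}_1,\dots,\mathbf{f}_n\}\subseteq\mathbb{Z}[t]^m$ be a parametric lattice basis sorted by degree, whose set of pilot vectors is linearly independent, and such that $\mathcal{B}_d\perp^{asym}\mathcal{B}_e$ whenever $d\neq e$, where $\mathcal{B}_d$ is the (ordered) sublist of elements of degree $d$. Let $1/4<\delta<\delta'<1$. If for each $d$ the list $\mathcal{B}_d$, considered as a basis on its own, satisfies the asymptotic Lovász condition with factor $\delta'$, then $\mathcal{B}$ satisfies the eventual Lovász condition with factor $\delta$.
   Context: A parametric lattice basis is a list $\mathbf{f}_1,\dots,\mathbf{f}_n\in\mathbb{Z}[t]^m$ with $\mathbf{f}_1(t),\dots,\mathbf{f}_n(t)$ linearly independent for all large $t$; sorted by degree means $\deg\mathbf{f}_i\le\deg\mathbf{f}_j$ for $i<j$, where $\deg$ is the maximum coordinate degree. The pilot vector $\widetilde{\mathbf{f}}$ is the vector of coefficients of $t^{\deg\mathbf{f}}$; $S\perp^{asym}T$ means the pilot vector of every element of $S$ is orthogonal to the pilot vector of every element of $T$. For a list $\mathbf{h}_1,\dots,\mathbf{h}_k$ with non-normalized Gram–Schmidt data over $\mathbb{Q}(t)$ ($\mathbf{h}_1^*=\mathbf{h}_1$, $\mathbf{h}_i^*=\mathbf{h}_i-\sum_{j<i}\rho_{i,j}\mathbf{h}_j^*$, $\rho_{i,j}=\langle\mathbf{h}_i,\mathbf{h}_j^*\rangle/\langle\mathbf{h}_j^*,\mathbf{h}_j^*\rangle$), the asymptotic Lovász condition with factor $\delta$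 is $\lim_{t\to\infty}\big(\|\mathbf{h}_i^*(t)\|^2/\|\mathbf{h}_{i-1}^*(t)\|^2+\rho_{i,i-1}(t)^2\big)\ge\delta$ for $2\le i\le k$ (limit may be $+\infty$), and the eventual Lovász condition is that the same inequality holds for all sufficiently large $t$.
   Formalization: The factors $\delta$ and $\delta'$ are rational numbers. -}

module Defs where

open import Data.Nat as ℕ using (ℕ; zero; suc; _⊔_)
open import Data.Integer as ℤ using (ℤ; +_)
open import Data.Rational as ℚ using (ℚ; 0ℚ; _+_; _*_; _-_; _÷_; _≤_; ≢-nonZero)
open import Data.Rational.Properties using () renaming (_≟_ to _≟ℚ_)
open import Data.List as List using (List; []; _∷_; filter)
open import Data.List.Relation.Unary.All using (All; all?)
open import Data.Vec as Vec using (Vec; []; _∷_; lookup; toList)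
open import Data.Fin using (Fin)
open import Data.Maybe using (Maybe; just; nothing)
open import Data.Product using (∃-syntax; _×_)
open import Data.Bool using (if_then_else_)
open import Relation.Nullary using (does; yes; no)
open import Relation.Binary.PropositionalEquality using (_≡_)

-- Integer polynomials in t, as coefficient lists [c₀, c₁, …] (low to high)

Poly : Set
Poly = List ℤ

coeff : Poly → ℕ → ℤ
coeff []       _       = + 0
coeff (c ∷ p)  zero    = c
coeff (c ∷ p)  (suc k) = coeff p k

-- degree (largest k with nonzero coefficient; 0 for the zero polynomial)
degP : Poly → ℕ
degP []      = 0
degP (c ∷ p) = if does (all? (λ x → x ℤ.≟ + 0) p) then 0 else suc (degP p)

evalP : Poly → ℕ → ℚ
evalP []      t = 0ℚ
evalP (c ∷ p) t = (c ℚ./ 1) + (+ t ℚ./ 1) * evalP p t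

PVec : ℕ → Set
PVec m = Vec Poly m

deg : ∀ {m} → PVec m → ℕ
deg f = Vec.foldr _ _⊔_ 0 (Vec.map degP f)

pilot : ∀ {m} → PVec m → Vec ℤ m
pilot f = Vec.map (λ p → coeff p (deg f)) f

evalV : ∀ {m} → PVec m → ℕ → Vec ℚ m
evalV f t = Vec.map (λ p → evalP p t) f

dot : ∀ {m} → Vec ℚ m → Vec ℚ m → ℚ
dot u v = Vec.foldr _ _+_ 0ℚ (Vec.zipWith _*_ u v)

dotℤ : ∀ {m} → Vec ℤ m → Vec ℤ m → ℤ
dotℤ u v = Vec.foldr _ ℤ._+_ (+ 0) (Vec.zipWith ℤ._*_ u v)

scale : ∀ {m} → ℚ → Vec ℚ m → Vec ℚ m
scale a v = Vec.map (a *_) v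

vsub : ∀ {m} → Vec ℚ m → Vec ℚ m → Vec ℚ m
vsub = Vec.zipWith _-_

vadd : ∀ {m} → Vec ℚ m → Vec ℚ m → Vec ℚ m
vadd = Vec.zipWith _+_

zeroV : ∀ {m} → Vec ℚ m
zeroV = Vec.replicate _ 0ℚ

toℚV : ∀ {m} → Vec ℤ m → Vec ℚ m
toℚV = Vec.map (λ z → z ℚ./ 1)

lincomb : ∀ {m n} → Vec ℚ n → Vec (Vec ℚ m) n → Vec ℚ m
lincomb []       []       = zeroV
lincomb (c ∷ cs) (v ∷ vs) = vadd (scale c v) (lincomb cs vs)

LinIndep : ∀ {m n} → Vec (Vec ℚ m) n → Set
LinIndep {n = n} vs = (c : Vec ℚ n) → lincomb c vs ≡ zeroV → c ≡ Vec.replicate n 0ℚ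

-- total division (x / 0 := 0); only used where the denominator is
-- eventually nonzero
_/′_ : ℚ → ℚ → ℚ
x /′ y with y ≟ℚ 0ℚ
... | yes _ = 0ℚ
... | no ne = _÷_ x y {{≢-nonZero ne}}

reduce : ∀ {m} → List (Vec ℚ m) → Vec ℚ m → Vec ℚ m
reduce []       h = h
reduce (s ∷ ss) h = vsub (reduce ss h) (scale (dot h s /′ dot s s) s)

gsAux : ∀ {m} → List (Vec ℚ m) → List (Vec ℚ m) → List (Vec ℚ m)
gsAux stars []       = []
gsAux stars (h ∷ hs) = let s = reduce stars h in s ∷ gsAux (s ∷ stars) hs

gs : ∀ {m} → List (Vec ℚ m) → List (Vec ℚ m)
gs = gsAux []

-- Lovász quantity for index i (given h_{i-1}*, h_i*, h_i):
--   ‖h_i*‖²/‖h_{i-1}*‖² + ρ_{i,i-1}²,  ρ_{i,i-1} = ⟨h_i,h_{i-1}*⟩/⟨h_{i-1}*,h_{i-1}*⟩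
lovVal : ∀ {m} → Vec ℚ m → Vec ℚ m → Vec ℚ m → ℚ
lovVal sPrev s h = (dot s s /′ dot sPrev sPrev) + (ρ * ρ)
  where ρ = dot h sPrev /′ dot sPrev sPrev

lovGo : ∀ {m} → List (Vec ℚ m) → List (Vec ℚ m) → List ℚ
lovGo (s₁ ∷ s₂ ∷ ss) (h₁ ∷ h₂ ∷ hs) = lovVal s₁ s₂ h₂ ∷ lovGo (s₂ ∷ ss) (h₂ ∷ hs)
lovGo _ _ = []

-- the list of Lovász quantities for i = 2,…,k
lovVals : ∀ {m} → List (Vec ℚ m) → List ℚ
lovVals hs = lovGo (gs hs) hs

nth : ∀ {A : Set} → List A → ℕ → Maybe A
nth []       _       = nothing
nth (x ∷ xs) zero    = just x
nth (x ∷ xs) (suc i) = nth xs i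

evalL : ∀ {m} → List (PVec m) → ℕ → List (Vec ℚ m)
evalL L t = List.map (λ f → evalV f t) L

-- asymptotic: for each index i (2 ≤ i ≤ k), lim_{t→∞} value_i(t) ≥ δ
-- (limit possibly +∞), written as: for every ε > 0, eventually value_i(t) ≥ δ - ε
AsymLovasz : ∀ {m} → ℚ → List (PVec m) → Set
AsymLovasz δ L =
  ∀ (i : ℕ) (ε : ℚ) → 0ℚ ℚ.< ε →
    ∃[ T ] ∀ (t : ℕ) → T ℕ.≤ t → ∀ (q : ℚ) →
      nth (lovVals (evalL L t)) i ≡ just q → δ - ε ≤ q

EventualLovasz : ∀ {m} → ℚ → List (PVec m) → Set
EventualLovasz δ L =
  ∃[ T ] ∀ (t : ℕ) → T ℕ.≤ t → All (δ ≤_) (lovVals (evalL L t))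

IsParamBasis : ∀ {m n} → Vec (PVec m) n → Set
IsParamBasis B = ∃[ T ] ∀ (t : ℕ) → T ℕ.≤ t → LinIndep (Vec.map (λ f → evalV f t) B)

SortedByDeg : ∀ {m n} → Vec (PVec m) n → Set
SortedByDeg {n = n} B = ∀ (i j : Fin n) → i Data.Fin.≤ j → deg (lookup B i) ℕ.≤ deg (lookup B j)

Bsub : ∀ {m n} → Vec (PVec m) n → ℕ → List (PVec m)
Bsub B d = filter (λ f → deg f ℕ.≟ d) (toList B)

AsymOrthDegrees : ∀ {m n} → Vec (PVec m) n → Set
AsymOrthDegrees {n = n} B = ∀ (i j : Fin n) → ¬ (deg (lookup B i) ≡ deg (lookup B j)) →
  dotℤ (pilot (lookup B i)) (pilot (lookup B j)) ≡ + 0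
  where open import Relation.Nullary using (¬_)

-- Write each basis vector as f(t) = t^(deg f) g_f(t); then g_f(t) tends to the pilot vector of f.
-- Gram–Schmidt commutes with rescaling each vector by a nonzero scalar, so the i-th Lovász value
-- of B(t) is (t^(dᵢ - dᵢ₋₁))² times the i-th Lovász value of the list g(t), and the latter tends to
-- the Lovász value of the pilot vectors: these are independent, so their Gram–Schmidt vectors are
-- nonzero and every quantity involved is continuous.  Pilot vectors of different degrees are
-- orthogonal, so Gram–Schmidt on the pilots runs separately in each degree block; at a pair of
-- equal degrees the limit is therefore the block's own limiting Lovász value, at least δ′ > δ by
-- hypothesis.  At a degree jump the factor is at least t while the limit is positive, so the value
-- eventually exceeds 1 > δ.

module Submission where

open import Defs
open import Data.Nat using (ℕ)
open import Data.Rational using (ℚ; _<_; _/_; 1ℚ)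
open import Data.Integer using (+_)
open import Data.Vec using (Vec; map; toList)

open import Algebra.Bundles using (CommutativeRing)
open import Data.Empty using (⊥-elim)
open import Data.Fin using (zero; suc)
open import Data.Integer as ℤ using (ℤ)
import Data.Integer.GCD as ℤ
import Data.Integer.Properties as ℤ
open import Data.List as List using (List; []; _∷_; _++_)
open import Data.List.Membership.Propositional using (_∈_)
open import Data.List.Membership.Propositional.Properties using (∈-++⁺ˡ; ∈-++⁺ʳ)
import Data.List.Properties as List
open import Data.List.Relation.Binary.Pointwise using (Pointwise; []; _∷_)
open import Data.List.Relation.Binary.Sublist.Propositional using (_⊆_; []; _∷_; _∷ʳ_; ⊆-refl)
import Data.List.Relation.Binary.Sublist.Propositional.Properties as ⊆
open import Data.List.Relation.Unary.All as All using (All; []; _∷_; all?)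
import Data.List.Relation.Unary.All.Properties as All
open import Data.List.Relation.Unary.AllPairs using (AllPairs; []; _∷_)
open import Data.List.Relation.Unary.Any using (here; there)
open import Data.Maybe as Maybe using (Maybe; just; nothing)
open import Data.Nat as ℕ using (zero; suc)
import Data.Nat.Properties as ℕ
open import Data.Product using (∃-syntax; _×_; _,_; proj₁; proj₂)
import Data.Product as Product
open import Data.Rational as ℚ
  using (0ℚ; _+_; _*_; _-_; -_; _≤_; ∣_∣; _⊓_; ↥_; ↧_; toℚᵘ; ≢-nonZero; positive; nonNegative)
open import Data.Rational.Properties
import Data.Rational.Unnormalised as ℚᵘ
import Data.Rational.Unnormalised.Properties as ℚᵘ
open import Data.Sum using (inj₁; inj₂)
open import Data.Unit using (⊤)
open import Data.Vec as Vec using ([]; _∷_)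
import Data.Vec.Properties as Vec
import Data.Vec.Relation.Unary.All as VecAll
open import Function using (_∘_)
open import Level using (0ℓ)
open import Relation.Binary.PropositionalEquality
open import Relation.Nullary using (¬_; Dec; yes; no)
open import Relation.Nullary.Decidable using (dec⇒maybe)
open import Tactic.RingSolver using (solve-∀)
open import Tactic.RingSolver.Core.AlmostCommutativeRing using (AlmostCommutativeRing; fromCommutativeRing)

open import Algebra.Properties.CommutativeSemiring.Exp
  (CommutativeRing.commutativeSemiring +-*-commutativeRing) using (_^_; ^-homo-*)

-- Rational arithmetic

ℚ-ring : AlmostCommutativeRing 0ℓ 0ℓ
ℚ-ring = fromCommutativeRing +-*-commutativeRing (λ x → dec⇒maybe (0ℚ ≟ x))

1/′_ : ℚ → ℚ
1/′ y = 1ℚ /′ y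

/′-≡-*1/′ : ∀ x y → x /′ y ≡ x * 1/′ y
/′-≡-*1/′ x y with y ≟ 0ℚ
... | yes _ = sym (*-zeroʳ x)
... | no _  = cong (x *_) (sym (*-identityˡ _))

*-1/′-inverseʳ : ∀ {y} → y ≢ 0ℚ → y * 1/′ y ≡ 1ℚ
*-1/′-inverseʳ {y} y≢0 with y ≟ 0ℚ
... | yes y≡0  = ⊥-elim (y≢0 y≡0)
... | no y≢0′ = trans (cong (y *_) (*-identityˡ _)) (*-inverseʳ y {{≢-nonZero y≢0′}})

*-1/′-cancelʳ : ∀ {y} x → y ≢ 0ℚ → x * y * 1/′ y ≡ x
*-1/′-cancelʳ {y} x y≢0 =
  trans (*-assoc x y (1/′ y)) (trans (cong (x *_) (*-1/′-inverseʳ y≢0)) (*-identityʳ x))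

*-≢0 : ∀ {x y} → x ≢ 0ℚ → y ≢ 0ℚ → x * y ≢ 0ℚ
*-≢0 {x} {y} x≢0 y≢0 xy≡0 = 1≢0 (begin
  1ℚ                         ≡⟨ cong₂ _*_ (*-1/′-inverseʳ x≢0) (*-1/′-inverseʳ y≢0) ⟨
  (x * 1/′ x) * (y * 1/′ y)  ≡⟨ regroup x y (1/′ x) (1/′ y) ⟩
  (x * y) * (1/′ x * 1/′ y)  ≡⟨ cong (_* (1/′ x * 1/′ y)) xy≡0 ⟩
  0ℚ * (1/′ x * 1/′ y)       ≡⟨ *-zeroˡ (1/′ x * 1/′ y) ⟩
  0ℚ                         ∎)
  where
  open ≡-Reasoning
  regroup : ∀ a b c d → (a * c) * (b * d) ≡ (a * b) * (c * d)
  regroup = solve-∀ ℚ-ring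

1/′-distrib-* : ∀ x y → 1/′ (x * y) ≡ 1/′ x * 1/′ y
1/′-distrib-* x y = by-cases (x ≟ 0ℚ) (y ≟ 0ℚ)
  where
  open ≡-Reasoning
  regroup : ∀ i a b c d → i * ((a * c) * (b * d)) ≡ ((a * b) * i) * (c * d)
  regroup = solve-∀ ℚ-ring
  by-cases : Dec (x ≡ 0ℚ) → Dec (y ≡ 0ℚ) → 1/′ (x * y) ≡ 1/′ x * 1/′ y
  by-cases (yes refl) _          = trans (cong 1/′_ (*-zeroˡ y)) (sym (*-zeroˡ (1/′ y)))
  by-cases (no _)     (yes refl) = trans (cong 1/′_ (*-zeroʳ x)) (sym (*-zeroʳ (1/′ x)))
  by-cases (no x≢0)   (no y≢0)   = begin
    1/′ (x * y)                                ≡⟨ *-identityʳ _ ⟨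
    1/′ (x * y) * 1ℚ                           ≡⟨ cong (1/′ (x * y) *_) (cong₂ _*_ (*-1/′-inverseʳ x≢0)
                                                                                 (*-1/′-inverseʳ y≢0)) ⟨
    1/′ (x * y) * ((x * 1/′ x) * (y * 1/′ y))  ≡⟨ regroup (1/′ (x * y)) x y (1/′ x) (1/′ y) ⟩
    ((x * y) * 1/′ (x * y)) * (1/′ x * 1/′ y)  ≡⟨ cong (_* (1/′ x * 1/′ y)) (*-1/′-inverseʳ (*-≢0 x≢0 y≢0)) ⟩
    1ℚ * (1/′ x * 1/′ y)                       ≡⟨ *-identityˡ _ ⟩
    1/′ x * 1/′ y                              ∎

pos⇒≢0 : ∀ {y} → 0ℚ < y → y ≢ 0ℚ
pos⇒≢0 y>0 y≡0 = <⇒≢ y>0 (sym y≡0)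

1/′-pos : ∀ {y} → 0ℚ < y → 0ℚ < 1/′ y
1/′-pos {y} y>0 with 1/′ y ≤? 0ℚ
... | no 1/′y≰0  = ≰⇒> 1/′y≰0
... | yes 1/′y≤0 = ⊥-elim (<-irrefl refl (<-≤-trans (positive⁻¹ 1ℚ) (begin
  1ℚ         ≡⟨ *-1/′-inverseʳ (pos⇒≢0 y>0) ⟨
  y * 1/′ y  ≤⟨ *-monoˡ-≤-nonNeg y {{nonNegative (<⇒≤ y>0)}} 1/′y≤0 ⟩
  y * 0ℚ     ≡⟨ *-zeroʳ y ⟩
  0ℚ         ∎)))
  where open ≤-Reasoning

*-pos : ∀ {p q} → 0ℚ < p → 0ℚ < q → 0ℚ < p * q
*-pos {p} {q} p>0 q>0 = positive⁻¹ (p * q) {{pos*pos⇒pos p {{positive p>0}} q {{positive q>0}}}}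

*-nonNeg : ∀ {p q} → 0ℚ ≤ p → 0ℚ ≤ q → 0ℚ ≤ p * q
*-nonNeg {p} {q} p≥0 q≥0 =
  nonNegative⁻¹ (p * q) {{nonNeg*nonNeg⇒nonNeg p {{nonNegative p≥0}} q {{nonNegative q≥0}}}}

*-mono-≤-nonNeg : ∀ {p q r s} → 0ℚ ≤ p → 0ℚ ≤ r → p ≤ q → r ≤ s → p * r ≤ q * s
*-mono-≤-nonNeg {p} {q} {r} {s} p≥0 r≥0 p≤q r≤s = ≤-trans
  (*-monoʳ-≤-nonNeg r {{nonNegative r≥0}} p≤q)
  (*-monoˡ-≤-nonNeg q {{nonNegative (≤-trans p≥0 p≤q)}} r≤s)

x*x≥0 : ∀ x → 0ℚ ≤ x * x
x*x≥0 x with ∣p∣≡p∨∣p∣≡-p x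
... | inj₁ ∣x∣≡x  = subst (λ y → 0ℚ ≤ y * y) ∣x∣≡x (*-nonNeg (0≤∣p∣ x) (0≤∣p∣ x))
... | inj₂ ∣x∣≡-x = subst (0ℚ ≤_) (trans (cong (λ y → y * y) ∣x∣≡-x) (neg*neg x))
                      (*-nonNeg (0≤∣p∣ x) (0≤∣p∣ x))
  where
  neg*neg : ∀ x → (- x) * (- x) ≡ x * x
  neg*neg = solve-∀ ℚ-ring

x*x≡0⇒x≡0 : ∀ x → x * x ≡ 0ℚ → x ≡ 0ℚ
x*x≡0⇒x≡0 x x*x≡0 with x ≟ 0ℚ
... | yes x≡0 = x≡0
... | no x≢0  = ⊥-elim (*-≢0 x≢0 x≢0 x*x≡0)

nonNeg+nonNeg≡0 : ∀ {p q} → 0ℚ ≤ p → 0ℚ ≤ q → p + q ≡ 0ℚ → p ≡ 0ℚ × q ≡ 0ℚ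
nonNeg+nonNeg≡0 {p} {q} p≥0 q≥0 p+q≡0 =
  ≤-antisym (subst₂ _≤_ (+-identityʳ p) p+q≡0 (+-monoʳ-≤ p q≥0)) p≥0 ,
  ≤-antisym (subst₂ _≤_ (+-identityˡ q) p+q≡0 (+-monoˡ-≤ q p≥0)) q≥0

p≤∣p∣ : ∀ p → p ≤ ∣ p ∣
p≤∣p∣ p with ∣p∣≡p∨∣p∣≡-p p
... | inj₁ ∣p∣≡p  = ≤-reflexive (sym ∣p∣≡p)
... | inj₂ ∣p∣≡-p = ≤-trans p≤0 (0≤∣p∣ p)
  where
  neg-involutive : ∀ p → - (- p) ≡ p
  neg-involutive = solve-∀ ℚ-ring
  p≤0 : p ≤ 0ℚ
  p≤0 = subst (_≤ 0ℚ) (neg-involutive p) (neg-antimono-≤ (subst (0ℚ ≤_) ∣p∣≡-p (0≤∣p∣ p)))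

∣p∣-pos : ∀ {p} → p ≢ 0ℚ → 0ℚ < ∣ p ∣
∣p∣-pos {p} p≢0 with ∣ p ∣ ≤? 0ℚ
... | no ∣p∣≰0  = ≰⇒> ∣p∣≰0
... | yes ∣p∣≤0 = ⊥-elim (p≢0 (∣p∣≡0⇒p≡0 p (≤-antisym ∣p∣≤0 (0≤∣p∣ p))))

∣p-q∣≡∣q-p∣ : ∀ p q → ∣ p - q ∣ ≡ ∣ q - p ∣
∣p-q∣≡∣q-p∣ p q = trans (sym (∣-p∣≡∣p∣ (p - q))) (cong ∣_∣ (neg-sub p q))
  where
  neg-sub : ∀ p q → - (p - q) ≡ q - p
  neg-sub = solve-∀ ℚ-ring

∣p-q∣≤ε⇒p≤q+ε : ∀ {p q ε} → ∣ p - q ∣ ≤ ε → p ≤ q + ε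
∣p-q∣≤ε⇒p≤q+ε {p} {q} {ε} ∣p-q∣≤ε =
  subst (_≤ q + ε) (q+[p-q] p q) (+-monoʳ-≤ q (≤-trans (p≤∣p∣ (p - q)) ∣p-q∣≤ε))
  where
  q+[p-q] : ∀ p q → q + (p - q) ≡ p
  q+[p-q] = solve-∀ ℚ-ring

∣p-q∣≤ε⇒q-ε≤p : ∀ {p q ε} → ∣ p - q ∣ ≤ ε → q - ε ≤ p
∣p-q∣≤ε⇒q-ε≤p {p} {q} {ε} ∣p-q∣≤ε = subst (q - ε ≤_) (q-[q-p] q p)
  (+-monoʳ-≤ q (neg-antimono-≤ (≤-trans (p≤∣p∣ (q - p)) (subst (_≤ ε) (∣p-q∣≡∣q-p∣ p q) ∣p-q∣≤ε))))
  where
  q-[q-p] : ∀ q p → q - (q - p) ≡ p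
  q-[q-p] = solve-∀ ℚ-ring

∣p∣*∣1/′p∣≡1 : ∀ {p} → p ≢ 0ℚ → ∣ p ∣ * ∣ 1/′ p ∣ ≡ 1ℚ
∣p∣*∣1/′p∣≡1 {p} p≢0 = trans (sym (∣p*q∣≡∣p∣*∣q∣ p (1/′ p))) (cong ∣_∣ (*-1/′-inverseʳ p≢0))

1/′-sub : ∀ {y L} → y ≢ 0ℚ → L ≢ 0ℚ → 1/′ y - 1/′ L ≡ (L - y) * 1/′ y * 1/′ L
1/′-sub {y} {L} y≢0 L≢0 = sym (begin
  (L - y) * 1/′ y * 1/′ L                    ≡⟨ expand L y (1/′ y) (1/′ L) ⟩
  (L * 1/′ L) * 1/′ y - (y * 1/′ y) * 1/′ L  ≡⟨ cong₂ (λ a b → a * 1/′ y - b * 1/′ L)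
                                                   (*-1/′-inverseʳ L≢0) (*-1/′-inverseʳ y≢0) ⟩
  1ℚ * 1/′ y - 1ℚ * 1/′ L                    ≡⟨ cong₂ _-_ (*-identityˡ (1/′ y)) (*-identityˡ (1/′ L)) ⟩
  1/′ y - 1/′ L                              ∎)
  where
  open ≡-Reasoning
  expand : ∀ L y a b → (L - y) * a * b ≡ (L * b) * a - (y * a) * b
  expand = solve-∀ ℚ-ring

+-cancelʳ-≤ : ∀ {p q} r → p + r ≤ q + r → p ≤ q
+-cancelʳ-≤ {p} {q} r p+r≤q+r = subst₂ _≤_ (p+r-r p r) (p+r-r q r) (+-monoˡ-≤ (- r) p+r≤q+r)
  where
  p+r-r : ∀ p r → p + r - r ≡ p
  p+r-r = solve-∀ ℚ-ring

⊓-pos : ∀ {p q} → 0ℚ < p → 0ℚ < q → 0ℚ < p ⊓ q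
⊓-pos {p} {q} p>0 q>0 with ⊓-sel p q
... | inj₁ p⊓q≡p = subst (0ℚ <_) (sym p⊓q≡p) p>0
... | inj₂ p⊓q≡q = subst (0ℚ <_) (sym p⊓q≡q) q>0

½ : ℚ
½ = + 1 / 2

½-pos : 0ℚ < ½
½-pos = positive⁻¹ ½

p*½+p*½≡p : ∀ p → p * ½ + p * ½ ≡ p
p*½+p*½≡p p = trans (sym (*-distribˡ-+ p ½ ½)) (*-identityʳ p)

p*½<p : ∀ {p} → 0ℚ < p → p * ½ < p
p*½<p {p} p>0 = subst₂ _<_ (+-identityˡ (p * ½)) (p*½+p*½≡p p) (+-monoˡ-< (p * ½) (*-pos p>0 ½-pos))

∣y-L∣≤∣L∣*½⇒∣L∣*½≤∣y∣ : ∀ {y L} → ∣ y - L ∣ ≤ ∣ L ∣ * ½ → ∣ L ∣ * ½ ≤ ∣ y ∣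
∣y-L∣≤∣L∣*½⇒∣L∣*½≤∣y∣ {y} {L} close = +-cancelʳ-≤ c (begin
  c + c              ≡⟨ p*½+p*½≡p ∣ L ∣ ⟩
  ∣ L ∣              ≡⟨ cong ∣_∣ (y+[L-y] y L) ⟨
  ∣ y + (L - y) ∣    ≤⟨ ∣p+q∣≤∣p∣+∣q∣ y (L - y) ⟩
  ∣ y ∣ + ∣ L - y ∣  ≤⟨ +-monoʳ-≤ ∣ y ∣ (subst (_≤ c) (∣p-q∣≡∣q-p∣ y L) close) ⟩
  ∣ y ∣ + c          ∎)
  where
  open ≤-Reasoning
  c = ∣ L ∣ * ½
  y+[L-y] : ∀ y L → y + (L - y) ≡ L
  y+[L-y] = solve-∀ ℚ-ring

^-inverse : ∀ {x y} n → x * y ≡ 1ℚ → x ^ n * y ^ n ≡ 1ℚ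
^-inverse         zero    _    = refl
^-inverse {x} {y} (suc n) xy≡1 = begin
  (x * x ^ n) * (y * y ^ n)  ≡⟨ interchange x (x ^ n) y (y ^ n) ⟩
  (x * y) * (x ^ n * y ^ n)  ≡⟨ cong₂ _*_ xy≡1 (^-inverse n xy≡1) ⟩
  1ℚ * 1ℚ                    ≡⟨ *-identityˡ 1ℚ ⟩
  1ℚ                         ∎
  where
  open ≡-Reasoning
  interchange : ∀ a b c d → (a * b) * (c * d) ≡ (a * c) * (b * d)
  interchange = solve-∀ ℚ-ring

1≤x⇒1≤x^n : ∀ {x} → 1ℚ ≤ x → ∀ n → 1ℚ ≤ x ^ n
1≤x⇒1≤x^n 1≤x zero    = ≤-refl
1≤x⇒1≤x^n 1≤x (suc n) = *-mono-≤-nonNeg (nonNegative⁻¹ 1ℚ) (nonNegative⁻¹ 1ℚ) 1≤x (1≤x⇒1≤x^n 1≤x n)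

1≤x⇒x≤x^[1+n] : ∀ {x} → 1ℚ ≤ x → ∀ n → x ≤ x ^ suc n
1≤x⇒x≤x^[1+n] {x} 1≤x n = subst (_≤ x ^ suc n) (*-identityʳ x)
  (*-monoˡ-≤-nonNeg x {{nonNegative (≤-trans (nonNegative⁻¹ 1ℚ) 1≤x)}} (1≤x⇒1≤x^n 1≤x n))

1≤x⇒x^n≢0 : ∀ {x} → 1ℚ ≤ x → ∀ n → x ^ n ≢ 0ℚ
1≤x⇒x^n≢0 1≤x n = pos⇒≢0 (<-≤-trans (positive⁻¹ 1ℚ) (1≤x⇒1≤x^n 1≤x n))

x^[a+k]/′x^a≡x^k : ∀ {x} a k → x ^ a ≢ 0ℚ → (x ^ (a ℕ.+ k)) /′ (x ^ a) ≡ x ^ k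
x^[a+k]/′x^a≡x^k {x} a k x^a≢0 = begin
  (x ^ (a ℕ.+ k)) /′ (x ^ a)   ≡⟨ /′-≡-*1/′ (x ^ (a ℕ.+ k)) (x ^ a) ⟩
  x ^ (a ℕ.+ k) * 1/′ (x ^ a)  ≡⟨ cong (_* 1/′ (x ^ a)) (trans (^-homo-* x a k) (*-comm (x ^ a) (x ^ k))) ⟩
  x ^ k * x ^ a * 1/′ (x ^ a)  ≡⟨ *-1/′-cancelʳ (x ^ k) x^a≢0 ⟩
  x ^ k                        ∎
  where open ≡-Reasoning

fromℤ : ℤ → ℚ
fromℤ z = z / 1

↥-fromℤ : ∀ z → ↥ (fromℤ z) ≡ z
↥-fromℤ z = trans (sym (ℤ.*-identityʳ _)) (trans (cong (↥ (fromℤ z) ℤ.*_) (sym (ℤ.gcd-zeroʳ z))) (↥-/ z 1))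

↧-fromℤ : ∀ z → ↧ (fromℤ z) ≡ + 1
↧-fromℤ z = trans (sym (ℤ.*-identityʳ _)) (trans (cong (↧ (fromℤ z) ℤ.*_) (sym (ℤ.gcd-zeroʳ z))) (↧-/ z 1))

fromℤ-mono-≤ : ∀ {a b} → a ℤ.≤ b → fromℤ a ≤ fromℤ b
fromℤ-mono-≤ {a} {b} a≤b = ℚ.*≤* (subst₂ ℤ._≤_
  (cong₂ ℤ._*_ (sym (↥-fromℤ a)) (sym (↧-fromℤ b))) (cong₂ ℤ._*_ (sym (↥-fromℤ b)) (sym (↧-fromℤ a)))
  (ℤ.*-monoʳ-≤-nonNeg (+ 1) a≤b))

toℚᵘ-fromℤ : ∀ z → toℚᵘ (fromℤ z) ℚᵘ.≃ ℚᵘ.mkℚᵘ z 0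
toℚᵘ-fromℤ z = toℚᵘ-fromℚᵘ (ℚᵘ.mkℚᵘ z 0)

fromℤ-+ : ∀ a b → fromℤ a + fromℤ b ≡ fromℤ (a ℤ.+ b)
fromℤ-+ a b = toℚᵘ-injective (ℚᵘ.≃-trans (toℚᵘ-homo-+ (fromℤ a) (fromℤ b))
  (ℚᵘ.≃-trans (ℚᵘ.+-cong (toℚᵘ-fromℤ a) (toℚᵘ-fromℤ b))
  (ℚᵘ.≃-trans (ℚᵘ.*≡* (cong (ℤ._* + 1) (cong₂ ℤ._+_ (ℤ.*-identityʳ a) (ℤ.*-identityʳ b))))
  (ℚᵘ.≃-sym (toℚᵘ-fromℤ (a ℤ.+ b))))))

fromℤ-* : ∀ a b → fromℤ a * fromℤ b ≡ fromℤ (a ℤ.* b)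
fromℤ-* a b = toℚᵘ-injective (ℚᵘ.≃-trans (toℚᵘ-homo-* (fromℤ a) (fromℤ b))
  (ℚᵘ.≃-trans (ℚᵘ.*-cong (toℚᵘ-fromℤ a) (toℚᵘ-fromℤ b)) (ℚᵘ.≃-sym (toℚᵘ-fromℤ (a ℤ.* b)))))

fromℕ : ℕ → ℚ
fromℕ t = fromℤ (+ t)

fromℕ-mono-≤ : ∀ {m n} → m ℕ.≤ n → fromℕ m ≤ fromℕ n
fromℕ-mono-≤ m≤n = fromℤ-mono-≤ (ℤ.+≤+ m≤n)

fromℕ-≥1 : ∀ {t} → 1 ℕ.≤ t → 1ℚ ≤ fromℕ t
fromℕ-≥1 = fromℕ-mono-≤

fromℕ-pos : ∀ {t} → 1 ℕ.≤ t → 0ℚ < fromℕ t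
fromℕ-pos 1≤t = <-≤-trans (positive⁻¹ 1ℚ) (fromℕ-≥1 1≤t)

-- Limits of rational sequences

Eventually : (ℕ → Set) → Set
Eventually P = ∃[ T ] ∀ t → T ℕ.≤ t → P t

eventually-∧ : ∀ {P Q : ℕ → Set} → Eventually P → Eventually Q → Eventually (λ t → P t × Q t)
eventually-∧ (T₁ , p) (T₂ , q) =
  T₁ ℕ.⊔ T₂ , λ t T≤t → p t (ℕ.m⊔n≤o⇒m≤o T₁ T₂ T≤t) , q t (ℕ.m⊔n≤o⇒n≤o T₁ T₂ T≤t)

eventually-map : ∀ {P Q : ℕ → Set} → (∀ {t} → P t → Q t) → Eventually P → Eventually Q
eventually-map f (T , p) = T , λ t T≤t → f (p t T≤t)

eventually-≥ : ∀ T → Eventually (T ℕ.≤_)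
eventually-≥ T = T , λ _ T≤t → T≤t

always : ∀ {P : ℕ → Set} → (∀ t → P t) → Eventually P
always p = 0 , λ t _ → p t

infix 4 _⟶_

_⟶_ : (ℕ → ℚ) → ℚ → Set
s ⟶ ℓ = ∀ ε → 0ℚ < ε → Eventually (λ t → ∣ s t - ℓ ∣ ≤ ε)

⟶-const : ∀ c → (λ _ → c) ⟶ c
⟶-const c ε ε>0 = always (λ _ → subst (_≤ ε) (cong ∣_∣ (sym (+-inverseʳ c))) (<⇒≤ ε>0))

⟶-cong : ∀ {s s′ ℓ} → Eventually (λ t → s t ≡ s′ t) → s ⟶ ℓ → s′ ⟶ ℓ
⟶-cong {ℓ = ℓ} s≡s′ s⟶ℓ ε ε>0 =
  eventually-map (λ (eq , close) → subst (λ x → ∣ x - ℓ ∣ ≤ ε) eq close) (eventually-∧ s≡s′ (s⟶ℓ ε ε>0))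

⟶-+ : ∀ {x y K L} → x ⟶ K → y ⟶ L → (λ t → x t + y t) ⟶ K + L
⟶-+ {x} {y} {K} {L} x⟶K y⟶L ε ε>0 = eventually-map bound
  (eventually-∧ (x⟶K (ε * ½) (*-pos ε>0 ½-pos)) (y⟶L (ε * ½) (*-pos ε>0 ½-pos)))
  where
  open ≤-Reasoning
  split : ∀ x y K L → (x + y) - (K + L) ≡ (x - K) + (y - L)
  split = solve-∀ ℚ-ring
  bound : ∀ {t} → ∣ x t - K ∣ ≤ ε * ½ × ∣ y t - L ∣ ≤ ε * ½ → ∣ (x t + y t) - (K + L) ∣ ≤ ε
  bound {t} (x-close , y-close) = begin
    ∣ (x t + y t) - (K + L) ∣  ≡⟨ cong ∣_∣ (split (x t) (y t) K L) ⟩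
    ∣ (x t - K) + (y t - L) ∣  ≤⟨ ∣p+q∣≤∣p∣+∣q∣ (x t - K) (y t - L) ⟩
    ∣ x t - K ∣ + ∣ y t - L ∣  ≤⟨ +-mono-≤ x-close y-close ⟩
    ε * ½ + ε * ½              ≡⟨ p*½+p*½≡p ε ⟩
    ε                          ∎

⟶-neg : ∀ {x K} → x ⟶ K → (λ t → - x t) ⟶ - K
⟶-neg {x} {K} x⟶K ε ε>0 = eventually-map
  (λ {t} close → subst (_≤ ε) (trans (sym (∣-p∣≡∣p∣ (x t - K))) (cong ∣_∣ (neg-sub (x t) K))) close)
  (x⟶K ε ε>0)
  where
  neg-sub : ∀ x K → - (x - K) ≡ (- x) - (- K)
  neg-sub = solve-∀ ℚ-ring

⟶-- : ∀ {x y K L} → x ⟶ K → y ⟶ L → (λ t → x t - y t) ⟶ K - L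
⟶-- {x} {y} x⟶K y⟶L = ⟶-+ {x} {λ t → - y t} x⟶K (⟶-neg {y} y⟶L)

⟶-* : ∀ {x y K L} → x ⟶ K → y ⟶ L → (λ t → x t * y t) ⟶ K * L
⟶-* {x} {y} {K} {L} x⟶K y⟶L ε ε>0 = eventually-map bound (eventually-∧ (x⟶K a a>0) (y⟶L a a>0))
  where
  open ≤-Reasoning
  M = 1ℚ + ∣ K ∣ + ∣ L ∣
  M>0 : 0ℚ < M
  M>0 = <-≤-trans (positive⁻¹ 1ℚ) (+-mono-≤ (+-monoʳ-≤ 1ℚ (0≤∣p∣ K)) (0≤∣p∣ L))
  a = 1ℚ ⊓ (ε * 1/′ M)
  a>0 : 0ℚ < a
  a>0 = ⊓-pos (positive⁻¹ 1ℚ) (*-pos ε>0 (1/′-pos M>0))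
  aM≤ε : a * M ≤ ε
  aM≤ε = begin
    a * M            ≤⟨ *-monoʳ-≤-nonNeg M {{nonNegative (<⇒≤ M>0)}} (p⊓q≤q 1ℚ (ε * 1/′ M)) ⟩
    ε * 1/′ M * M    ≡⟨ *-assoc ε (1/′ M) M ⟩
    ε * (1/′ M * M)  ≡⟨ cong (ε *_) (trans (*-comm (1/′ M) M) (*-1/′-inverseʳ (pos⇒≢0 M>0))) ⟩
    ε * 1ℚ           ≡⟨ *-identityʳ ε ⟩
    ε                ∎
  expand : ∀ x y K L → x * y - K * L ≡ (x - K) * (y - L) + K * (y - L) + L * (x - K)
  expand = solve-∀ ℚ-ring
  collect : ∀ a k l → 1ℚ * a + k * a + l * a ≡ a * (1ℚ + k + l)
  collect = solve-∀ ℚ-ring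
  bound : ∀ {t} → ∣ x t - K ∣ ≤ a × ∣ y t - L ∣ ≤ a → ∣ x t * y t - K * L ∣ ≤ ε
  bound {t} (x-close , y-close) = begin
    ∣ x t * y t - K * L ∣
      ≡⟨ cong ∣_∣ (expand (x t) (y t) K L) ⟩
    ∣ u * v + K * v + L * u ∣
      ≤⟨ ≤-trans (∣p+q∣≤∣p∣+∣q∣ (u * v + K * v) (L * u)) (+-monoˡ-≤ ∣ L * u ∣ (∣p+q∣≤∣p∣+∣q∣ (u * v) (K * v))) ⟩
    ∣ u * v ∣ + ∣ K * v ∣ + ∣ L * u ∣
      ≡⟨ cong₂ _+_ (cong₂ _+_ (∣p*q∣≡∣p∣*∣q∣ u v) (∣p*q∣≡∣p∣*∣q∣ K v)) (∣p*q∣≡∣p∣*∣q∣ L u) ⟩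
    ∣ u ∣ * ∣ v ∣ + ∣ K ∣ * ∣ v ∣ + ∣ L ∣ * ∣ u ∣
      ≤⟨ +-mono-≤ (+-mono-≤ (*-mono-≤-nonNeg (0≤∣p∣ u) (0≤∣p∣ v) ∣u∣≤1 y-close)
                            (*-mono-≤-nonNeg (0≤∣p∣ K) (0≤∣p∣ v) ≤-refl y-close))
                  (*-mono-≤-nonNeg (0≤∣p∣ L) (0≤∣p∣ u) ≤-refl x-close) ⟩
    1ℚ * a + ∣ K ∣ * a + ∣ L ∣ * a
      ≡⟨ collect a ∣ K ∣ ∣ L ∣ ⟩
    a * M
      ≤⟨ aM≤ε ⟩
    ε
      ∎
    where
    u = x t - K
    v = y t - L
    ∣u∣≤1 : ∣ u ∣ ≤ 1ℚ
    ∣u∣≤1 = ≤-trans x-close (p⊓q≤p 1ℚ (ε * 1/′ M))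

⟶-1/′ : ∀ {y L} → y ⟶ L → L ≢ 0ℚ → (λ t → 1/′ y t) ⟶ 1/′ L
⟶-1/′ {y} {L} y⟶L L≢0 ε ε>0 = eventually-map bound (y⟶L a a>0)
  where
  open ≤-Reasoning
  ∣L∣>0 = ∣p∣-pos L≢0
  c = ∣ L ∣ * ½
  c>0 = *-pos ∣L∣>0 ½-pos
  a = c ⊓ (ε * (c * ∣ L ∣))
  a>0 = ⊓-pos c>0 (*-pos ε>0 (*-pos c>0 ∣L∣>0))
  regroup : ∀ e c l a b → e * (c * l) * a * b ≡ e * ((c * a) * (l * b))
  regroup = solve-∀ ℚ-ring
  bound : ∀ {t} → ∣ y t - L ∣ ≤ a → ∣ 1/′ y t - 1/′ L ∣ ≤ ε
  bound {t} close = begin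
    ∣ 1/′ y t - 1/′ L ∣
      ≡⟨ cong ∣_∣ (1/′-sub y≢0 L≢0) ⟩
    ∣ (L - y t) * 1/′ y t * 1/′ L ∣
      ≡⟨ trans (∣p*q∣≡∣p∣*∣q∣ ((L - y t) * 1/′ y t) (1/′ L))
               (cong (_* ∣ 1/′ L ∣) (∣p*q∣≡∣p∣*∣q∣ (L - y t) (1/′ y t))) ⟩
    ∣ L - y t ∣ * ∣ 1/′ y t ∣ * ∣ 1/′ L ∣
      ≤⟨ *-monoʳ-≤-nonNeg ∣ 1/′ L ∣ {{nonNegative (0≤∣p∣ (1/′ L))}}
           (*-monoʳ-≤-nonNeg ∣ 1/′ y t ∣ {{nonNegative (0≤∣p∣ (1/′ y t))}} ∣L-y∣≤εc∣L∣) ⟩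
    ε * (c * ∣ L ∣) * ∣ 1/′ y t ∣ * ∣ 1/′ L ∣
      ≡⟨ regroup ε c ∣ L ∣ ∣ 1/′ y t ∣ ∣ 1/′ L ∣ ⟩
    ε * ((c * ∣ 1/′ y t ∣) * (∣ L ∣ * ∣ 1/′ L ∣))
      ≤⟨ *-monoˡ-≤-nonNeg ε {{nonNegative (<⇒≤ ε>0)}}
           (*-monoʳ-≤-nonNeg (∣ L ∣ * ∣ 1/′ L ∣) {{nonNegative (*-nonNeg (0≤∣p∣ L) (0≤∣p∣ (1/′ L)))}} c∣1/′y∣≤1) ⟩
    ε * (1ℚ * (∣ L ∣ * ∣ 1/′ L ∣))
      ≡⟨ cong (ε *_) (trans (*-identityˡ (∣ L ∣ * ∣ 1/′ L ∣)) (∣p∣*∣1/′p∣≡1 L≢0)) ⟩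
    ε * 1ℚ
      ≡⟨ *-identityʳ ε ⟩
    ε
      ∎
    where
    c≤∣y∣ : c ≤ ∣ y t ∣
    c≤∣y∣ = ∣y-L∣≤∣L∣*½⇒∣L∣*½≤∣y∣ (≤-trans close (p⊓q≤p c _))
    y≢0 : y t ≢ 0ℚ
    y≢0 y≡0 = <-irrefl refl (<-≤-trans c>0 (subst (λ z → c ≤ ∣ z ∣) y≡0 c≤∣y∣))
    ∣L-y∣≤εc∣L∣ : ∣ L - y t ∣ ≤ ε * (c * ∣ L ∣)
    ∣L-y∣≤εc∣L∣ = subst (_≤ _) (∣p-q∣≡∣q-p∣ (y t) L) (≤-trans close (p⊓q≤q c _))
    c∣1/′y∣≤1 : c * ∣ 1/′ y t ∣ ≤ 1ℚ
    c∣1/′y∣≤1 = ≤-trans (*-monoʳ-≤-nonNeg ∣ 1/′ y t ∣ {{nonNegative (0≤∣p∣ (1/′ y t))}} c≤∣y∣)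
                        (≤-reflexive (∣p∣*∣1/′p∣≡1 y≢0))

⟶-/′ : ∀ {x y K L} → x ⟶ K → y ⟶ L → L ≢ 0ℚ → (λ t → x t /′ y t) ⟶ K /′ L
⟶-/′ {x} {y} {K} {L} x⟶K y⟶L L≢0 = subst ((λ t → x t /′ y t) ⟶_) (sym (/′-≡-*1/′ K L))
  (⟶-cong (always (λ t → sym (/′-≡-*1/′ (x t) (y t)))) (⟶-* {x} {λ t → 1/′ y t} x⟶K (⟶-1/′ {y} y⟶L L≢0)))

⟶-^ : ∀ {x K} n → x ⟶ K → (λ t → x t ^ n) ⟶ K ^ n
⟶-^     zero    x⟶K = ⟶-const 1ℚ
⟶-^ {x} (suc n) x⟶K = ⟶-* {x} {λ t → x t ^ n} x⟶K (⟶-^ n x⟶K)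

⟶-≥ : ∀ {s ℓ δ} → s ⟶ ℓ → (∀ ε → 0ℚ < ε → Eventually (λ t → δ - ε ≤ s t)) → δ ≤ ℓ
⟶-≥ {s} {ℓ} {δ} s⟶ℓ above with δ ≤? ℓ
... | yes δ≤ℓ = δ≤ℓ
... | no δ≰ℓ  = ⊥-elim (<-irrefl refl (<-≤-trans (p*½<p d>0) d≤d*½))
  where
  open ≤-Reasoning
  d = δ - ℓ
  d>0 : 0ℚ < d
  d>0 = subst (_< d) (+-inverseʳ ℓ) (+-monoˡ-< (- ℓ) (≰⇒> δ≰ℓ))
  ε = d * ½ * ½
  ε>0 = *-pos (*-pos d>0 ½-pos) ½-pos
  witness = proj₂ (eventually-∧ (s⟶ℓ ε ε>0) (above ε ε>0)) _ ℕ.≤-refl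
  rearrange : ∀ δ ℓ e → δ - ℓ ≡ (δ - e) - (ℓ + e) + (e + e)
  rearrange = solve-∀ ℚ-ring
  d≤d*½ : d ≤ d * ½
  d≤d*½ = begin
    d                            ≡⟨ rearrange δ ℓ ε ⟩
    (δ - ε) - (ℓ + ε) + (ε + ε)  ≤⟨ +-monoˡ-≤ (ε + ε) (+-monoˡ-≤ (- (ℓ + ε))
                                      (≤-trans (proj₂ witness) (∣p-q∣≤ε⇒p≤q+ε (proj₁ witness)))) ⟩
    (ℓ + ε) - (ℓ + ε) + (ε + ε)  ≡⟨ cong (_+ (ε + ε)) (+-inverseʳ (ℓ + ε)) ⟩
    0ℚ + (ε + ε)                 ≡⟨ trans (+-identityˡ _) (p*½+p*½≡p (d * ½)) ⟩
    d * ½                        ∎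

⟶⇒eventually-≥ : ∀ {s ℓ δ} → s ⟶ ℓ → δ < ℓ → Eventually (λ t → δ ≤ s t)
⟶⇒eventually-≥ {s} {ℓ} {δ} s⟶ℓ δ<ℓ = eventually-map
  (λ close → subst (_≤ _) (ℓ-[ℓ-δ] ℓ δ) (∣p-q∣≤ε⇒q-ε≤p close))
  (s⟶ℓ (ℓ - δ) (subst (_< ℓ - δ) (+-inverseʳ δ) (+-monoˡ-< (- δ) δ<ℓ)))
  where
  ℓ-[ℓ-δ] : ∀ ℓ δ → ℓ - (ℓ - δ) ≡ δ
  ℓ-[ℓ-δ] = solve-∀ ℚ-ring

archimedean : ∀ q → Eventually (λ t → q ≤ fromℕ t)
archimedean q = ℤ.∣ ↥ q ∣ , λ t ∣↥q∣≤t → ≤-trans (p≤∣p∣ q) (≤-trans (∣q∣≤∣↥q∣ q) (fromℕ-mono-≤ ∣↥q∣≤t))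
  where
  ∣q∣≤∣↥q∣ : ∀ q → ∣ q ∣ ≤ fromℕ ℤ.∣ ↥ q ∣
  ∣q∣≤∣↥q∣ (ℚ.mkℚ n d-1 _) = ℚ.*≤* (subst₂ ℤ._≤_
    (cong (+ ℤ.∣ n ∣ ℤ.*_) (sym (↧-fromℤ (+ ℤ.∣ n ∣)))) (cong (ℤ._* + suc d-1) (sym (↥-fromℤ (+ ℤ.∣ n ∣))))
    (subst₂ ℤ._≤_ (sym (ℤ.*-identityʳ _)) (ℤ.pos-* ℤ.∣ n ∣ (suc d-1)) (ℤ.+≤+ (ℕ.m≤m*n ℤ.∣ n ∣ (suc d-1)))))

1/′fromℕ⟶0 : (λ t → 1/′ fromℕ t) ⟶ 0ℚ
1/′fromℕ⟶0 ε ε>0 = eventually-map bound (eventually-∧ (eventually-≥ 1) (archimedean (1/′ ε)))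
  where
  open ≤-Reasoning
  swap : ∀ u e t → u * e * t ≡ e * (t * u)
  swap = solve-∀ ℚ-ring
  bound : ∀ {t} → 1 ℕ.≤ t × 1/′ ε ≤ fromℕ t → ∣ 1/′ fromℕ t - 0ℚ ∣ ≤ ε
  bound {t} (1≤t , 1/′ε≤t) = begin
    ∣ 1/′ fromℕ t - 0ℚ ∣         ≡⟨ trans (cong ∣_∣ (+-identityʳ (1/′ fromℕ t))) (0≤p⇒∣p∣≡p u≥0) ⟩
    1/′ fromℕ t                  ≡⟨ *-1/′-cancelʳ (1/′ fromℕ t) (pos⇒≢0 ε>0) ⟨
    1/′ fromℕ t * ε * 1/′ ε      ≤⟨ *-monoˡ-≤-nonNeg (1/′ fromℕ t * ε) {{nonNegative (*-nonNeg u≥0 (<⇒≤ ε>0))}}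
                                      1/′ε≤t ⟩
    1/′ fromℕ t * ε * fromℕ t    ≡⟨ swap (1/′ fromℕ t) ε (fromℕ t) ⟩
    ε * (fromℕ t * 1/′ fromℕ t)  ≡⟨ cong (ε *_) (*-1/′-inverseʳ (pos⇒≢0 (fromℕ-pos 1≤t))) ⟩
    ε * 1ℚ                       ≡⟨ *-identityʳ ε ⟩
    ε                            ∎
    where
    u≥0 = <⇒≤ (1/′-pos (fromℕ-pos 1≤t))

-- Vectors over ℚ and their limits

NonNull : ∀ {m} → Vec ℚ m → Set
NonNull v = dot v v ≢ 0ℚ

dot-comm : ∀ {m} (u v : Vec ℚ m) → dot u v ≡ dot v u
dot-comm []      []      = refl
dot-comm (x ∷ u) (y ∷ v) = cong₂ _+_ (*-comm x y) (dot-comm u v)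

dot-self-nonNeg : ∀ {m} (v : Vec ℚ m) → 0ℚ ≤ dot v v
dot-self-nonNeg []      = ≤-refl
dot-self-nonNeg (x ∷ v) = +-mono-≤ (x*x≥0 x) (dot-self-nonNeg v)

dot-self≡0⇒≡zeroV : ∀ {m} (v : Vec ℚ m) → dot v v ≡ 0ℚ → v ≡ zeroV
dot-self≡0⇒≡zeroV []      _        = refl
dot-self≡0⇒≡zeroV (x ∷ v) vv≡0 with nonNeg+nonNeg≡0 (x*x≥0 x) (dot-self-nonNeg v) vv≡0
... | xx≡0 , rest≡0 = cong₂ _∷_ (x*x≡0⇒x≡0 x xx≡0) (dot-self≡0⇒≡zeroV v rest≡0)

dot-scaleˡ : ∀ {m} a (u v : Vec ℚ m) → dot (scale a u) v ≡ a * dot u v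
dot-scaleˡ a []      []      = sym (*-zeroʳ a)
dot-scaleˡ a (x ∷ u) (y ∷ v) =
  trans (cong (λ z → a * x * y + z) (dot-scaleˡ a u v)) (factor a x y (dot u v))
  where
  factor : ∀ a x y d → a * x * y + a * d ≡ a * (x * y + d)
  factor = solve-∀ ℚ-ring

dot-scaleʳ : ∀ {m} b (u v : Vec ℚ m) → dot u (scale b v) ≡ b * dot u v
dot-scaleʳ b u v = trans (dot-comm u (scale b v)) (trans (dot-scaleˡ b v u) (cong (b *_) (dot-comm v u)))

dot-scale-scale : ∀ {m} a b (u v : Vec ℚ m) → dot (scale a u) (scale b v) ≡ a * b * dot u v
dot-scale-scale a b u v =
  trans (dot-scaleˡ a u (scale b v)) (trans (cong (a *_) (dot-scaleʳ b u v)) (sym (*-assoc a b _)))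

dot-vsubʳ : ∀ {m} (x u v : Vec ℚ m) → dot x (vsub u v) ≡ dot x u - dot x v
dot-vsubʳ []      []      []      = refl
dot-vsubʳ (a ∷ x) (b ∷ u) (c ∷ v) =
  trans (cong (λ z → a * (b - c) + z) (dot-vsubʳ x u v)) (distrib a b c (dot x u) (dot x v))
  where
  distrib : ∀ a b c p q → a * (b - c) + (p - q) ≡ (a * b + p) - (a * c + q)
  distrib = solve-∀ ℚ-ring

scale-scale : ∀ {m} a b (v : Vec ℚ m) → scale a (scale b v) ≡ scale (a * b) v
scale-scale a b []      = refl
scale-scale a b (x ∷ v) = cong₂ _∷_ (sym (*-assoc a b x)) (scale-scale a b v)

scale-vsub : ∀ {m} c (u v : Vec ℚ m) → scale c (vsub u v) ≡ vsub (scale c u) (scale c v)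
scale-vsub c []      []      = refl
scale-vsub c (x ∷ u) (y ∷ v) = cong₂ _∷_ (distrib c x y) (scale-vsub c u v)
  where
  distrib : ∀ c x y → c * (x - y) ≡ c * x - c * y
  distrib = solve-∀ ℚ-ring

scale-one : ∀ {m} (v : Vec ℚ m) → scale 1ℚ v ≡ v
scale-one []      = refl
scale-one (x ∷ v) = cong₂ _∷_ (*-identityˡ x) (scale-one v)

scale-zero : ∀ {m} (v : Vec ℚ m) → scale 0ℚ v ≡ zeroV
scale-zero []      = refl
scale-zero (x ∷ v) = cong₂ _∷_ (*-zeroˡ x) (scale-zero v)

scale-zeroV : ∀ {m} a → scale a (zeroV {m}) ≡ zeroV
scale-zeroV {zero}  a = refl
scale-zeroV {suc m} a = cong₂ _∷_ (*-zeroʳ a) (scale-zeroV {m} a)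

scale-+ : ∀ {m} a b (v : Vec ℚ m) → scale (a + b) v ≡ vadd (scale a v) (scale b v)
scale-+ a b []      = refl
scale-+ a b (x ∷ v) = cong₂ _∷_ (*-distribʳ-+ x a b) (scale-+ a b v)

scale-vadd : ∀ {m} a (u v : Vec ℚ m) → scale a (vadd u v) ≡ vadd (scale a u) (scale a v)
scale-vadd a []      []      = refl
scale-vadd a (x ∷ u) (y ∷ v) = cong₂ _∷_ (*-distribˡ-+ a x y) (scale-vadd a u v)

vsub-zeroV : ∀ {m} (v : Vec ℚ m) → vsub v zeroV ≡ v
vsub-zeroV []      = refl
vsub-zeroV (x ∷ v) = cong₂ _∷_ (+-identityʳ x) (vsub-zeroV v)

vadd-identityˡ : ∀ {m} (v : Vec ℚ m) → vadd zeroV v ≡ v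
vadd-identityˡ []      = refl
vadd-identityˡ (x ∷ v) = cong₂ _∷_ (+-identityˡ x) (vadd-identityˡ v)

vadd-identityʳ : ∀ {m} (v : Vec ℚ m) → vadd v zeroV ≡ v
vadd-identityʳ []      = refl
vadd-identityʳ (x ∷ v) = cong₂ _∷_ (+-identityʳ x) (vadd-identityʳ v)

vadd-assoc : ∀ {m} (u v w : Vec ℚ m) → vadd (vadd u v) w ≡ vadd u (vadd v w)
vadd-assoc []      []      []      = refl
vadd-assoc (x ∷ u) (y ∷ v) (z ∷ w) = cong₂ _∷_ (+-assoc x y z) (vadd-assoc u v w)

vadd-interchange : ∀ {m} (a b c d : Vec ℚ m) → vadd (vadd a b) (vadd c d) ≡ vadd (vadd a c) (vadd b d)
vadd-interchange []       []       []       []       = refl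
vadd-interchange (a ∷ as) (b ∷ bs) (c ∷ cs) (d ∷ ds) =
  cong₂ _∷_ (interchange a b c d) (vadd-interchange as bs cs ds)
  where
  interchange : ∀ a b c d → (a + b) + (c + d) ≡ (a + c) + (b + d)
  interchange = solve-∀ ℚ-ring

vsub≡vadd-neg : ∀ {m} (u v : Vec ℚ m) → vsub u v ≡ vadd u (scale (- 1ℚ) v)
vsub≡vadd-neg []      []      = refl
vsub≡vadd-neg (x ∷ u) (y ∷ v) = cong₂ _∷_ (x-y x y) (vsub≡vadd-neg u v)
  where
  x-y : ∀ x y → x - y ≡ x + (- 1ℚ) * y
  x-y = solve-∀ ℚ-ring

vsub-vsub : ∀ {m} (u v w : Vec ℚ m) → vsub (vsub u v) w ≡ vsub u (vadd v w)
vsub-vsub []      []      []      = refl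
vsub-vsub (x ∷ u) (y ∷ v) (z ∷ w) = cong₂ _∷_ (x-y-z x y z) (vsub-vsub u v w)
  where
  x-y-z : ∀ x y z → (x - y) - z ≡ x - (y + z)
  x-y-z = solve-∀ ℚ-ring

vsub≡zeroV⇒≡ : ∀ {m} (u v : Vec ℚ m) → vsub u v ≡ zeroV → u ≡ v
vsub≡zeroV⇒≡ []      []      _    = refl
vsub≡zeroV⇒≡ (x ∷ u) (y ∷ v) u-v≡0 = cong₂ _∷_
  (trans (x≡[x-y]+y x y) (trans (cong (_+ y) (cong Vec.head u-v≡0)) (+-identityˡ y)))
  (vsub≡zeroV⇒≡ u v (cong Vec.tail u-v≡0))
  where
  x≡[x-y]+y : ∀ x y → x ≡ (x - y) + y
  x≡[x-y]+y = solve-∀ ℚ-ring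

vadd-inverseʳ : ∀ {m} (v : Vec ℚ m) → vadd v (scale (- 1ℚ) v) ≡ zeroV
vadd-inverseʳ []      = refl
vadd-inverseʳ (x ∷ v) = cong₂ _∷_ (x-x x) (vadd-inverseʳ v)
  where
  x-x : ∀ x → x + (- 1ℚ) * x ≡ 0ℚ
  x-x = solve-∀ ℚ-ring

dot-toℚV : ∀ {k} (a b : Vec ℤ k) → dot (toℚV a) (toℚV b) ≡ fromℤ (dotℤ a b)
dot-toℚV []      []      = refl
dot-toℚV (x ∷ a) (y ∷ b) =
  trans (cong₂ _+_ (fromℤ-* x y) (dot-toℚV a b)) (fromℤ-+ (x ℤ.* y) (dotℤ a b))

module _ {A B : Set} {m : ℕ} where

  head-map : ∀ (f : A → B) (u : Vec A (suc m)) → Vec.head (Vec.map f u) ≡ f (Vec.head u)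
  head-map f (x ∷ u) = refl

  tail-map : ∀ (f : A → B) (u : Vec A (suc m)) → Vec.tail (Vec.map f u) ≡ Vec.map f (Vec.tail u)
  tail-map f (x ∷ u) = refl

  head-zipWith : ∀ (f : A → A → B) (u v : Vec A (suc m)) →
                 Vec.head (Vec.zipWith f u v) ≡ f (Vec.head u) (Vec.head v)
  head-zipWith f (x ∷ u) (y ∷ v) = refl

  tail-zipWith : ∀ (f : A → A → B) (u v : Vec A (suc m)) →
                 Vec.tail (Vec.zipWith f u v) ≡ Vec.zipWith f (Vec.tail u) (Vec.tail v)
  tail-zipWith f (x ∷ u) (y ∷ v) = refl

dot-[] : (u v : Vec ℚ 0) → dot u v ≡ 0ℚ
dot-[] [] [] = refl

dot-∷ : ∀ {m} (u v : Vec ℚ (suc m)) → dot u v ≡ Vec.head u * Vec.head v + dot (Vec.tail u) (Vec.tail v)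
dot-∷ (x ∷ u) (y ∷ v) = refl

infix 4 _⟶ⱽ_

_⟶ⱽ_ : ∀ {m} → (ℕ → Vec ℚ m) → Vec ℚ m → Set
_⟶ⱽ_ {zero}  s v = ⊤
_⟶ⱽ_ {suc m} s v = (λ t → Vec.head (s t)) ⟶ Vec.head v × (λ t → Vec.tail (s t)) ⟶ⱽ Vec.tail v

⟶ⱽ-cong : ∀ {m} {s s′ : ℕ → Vec ℚ m} {v} →
          Eventually (λ t → s t ≡ s′ t) → s ⟶ⱽ v → s′ ⟶ⱽ v
⟶ⱽ-cong {zero}  _    _                     = _
⟶ⱽ-cong {suc m} s≡s′ (head⟶ , tail⟶) =
  ⟶-cong (eventually-map (cong Vec.head) s≡s′) head⟶ ,
  ⟶ⱽ-cong {m} (eventually-map (cong Vec.tail) s≡s′) tail⟶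

⟶-dot : ∀ {m} {s r : ℕ → Vec ℚ m} {v w} →
        s ⟶ⱽ v → r ⟶ⱽ w → (λ t → dot (s t) (r t)) ⟶ dot v w
⟶-dot {zero} {s} {r} {v} {w} _ _ = subst ((λ t → dot (s t) (r t)) ⟶_) (sym (dot-[] v w))
  (⟶-cong {ℓ = 0ℚ} (always (λ t → sym (dot-[] (s t) (r t)))) (⟶-const 0ℚ))
⟶-dot {suc m} {s} {r} {v} {w} (s₀⟶ , s′⟶) (r₀⟶ , r′⟶) =
  subst ((λ t → dot (s t) (r t)) ⟶_) (sym (dot-∷ v w))
  (⟶-cong (always (λ t → sym (dot-∷ (s t) (r t))))
    (⟶-+ {λ t → Vec.head (s t) * Vec.head (r t)} {λ t → dot (Vec.tail (s t)) (Vec.tail (r t))}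
      (⟶-* {λ t → Vec.head (s t)} {λ t → Vec.head (r t)} s₀⟶ r₀⟶) (⟶-dot {m} s′⟶ r′⟶)))

⟶ⱽ-vsub : ∀ {m} {s r : ℕ → Vec ℚ m} {v w} →
          s ⟶ⱽ v → r ⟶ⱽ w → (λ t → vsub (s t) (r t)) ⟶ⱽ vsub v w
⟶ⱽ-vsub {zero}  _ _ = _
⟶ⱽ-vsub {suc m} {s} {r} {v} {w} (s₀⟶ , s′⟶) (r₀⟶ , r′⟶) =
  subst ((λ t → Vec.head (vsub (s t) (r t))) ⟶_) (sym (head-zipWith _-_ v w))
    (⟶-cong (always (λ t → sym (head-zipWith _-_ (s t) (r t))))
      (⟶-- {λ t → Vec.head (s t)} {λ t → Vec.head (r t)} s₀⟶ r₀⟶)) ,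
  subst ((λ t → Vec.tail (vsub (s t) (r t))) ⟶ⱽ_) (sym (tail-zipWith _-_ v w))
    (⟶ⱽ-cong {m} (always (λ t → sym (tail-zipWith _-_ (s t) (r t)))) (⟶ⱽ-vsub {m} s′⟶ r′⟶))

⟶ⱽ-scale : ∀ {m} {a : ℕ → ℚ} {s : ℕ → Vec ℚ m} {K v} →
           a ⟶ K → s ⟶ⱽ v → (λ t → scale (a t) (s t)) ⟶ⱽ scale K v
⟶ⱽ-scale {zero}  _ _ = _
⟶ⱽ-scale {suc m} {a} {s} {K} {v} a⟶K (s₀⟶ , s′⟶) =
  subst ((λ t → Vec.head (scale (a t) (s t))) ⟶_) (sym (head-map (K *_) v))
    (⟶-cong (always (λ t → sym (head-map (a t *_) (s t))))
      (⟶-* {a} {λ t → Vec.head (s t)} a⟶K s₀⟶)) ,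
  subst ((λ t → Vec.tail (scale (a t) (s t))) ⟶ⱽ_) (sym (tail-map (K *_) v))
    (⟶ⱽ-cong {m} (always (λ t → sym (tail-map (a t *_) (s t)))) (⟶ⱽ-scale {m} {a} a⟶K s′⟶))

-- Polynomials and parametric vectors

evalP-allZero : ∀ {q} → All (_≡ + 0) q → ∀ t → evalP q t ≡ 0ℚ
evalP-allZero []           t = refl
evalP-allZero (refl ∷ q≡0) t = trans (cong (λ z → 0ℚ + fromℕ t * z) (evalP-allZero q≡0 t))
                                     (trans (+-identityˡ _) (*-zeroʳ (fromℕ t)))

degP-allZero : ∀ {q} → All (_≡ + 0) q → degP q ≡ 0
degP-allZero []                = refl
degP-allZero {c ∷ q} (_ ∷ q≡0) with all? (ℤ._≟ + 0) q
... | yes _  = refl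
... | no q≢0 = ⊥-elim (q≢0 q≡0)

degP-∷ : ∀ {c q D} → degP (c ∷ q) ℕ.≤ suc D → degP q ℕ.≤ D
degP-∷ {c} {q} {D} deg≤ with all? (ℤ._≟ + 0) q
... | yes q≡0 = subst (ℕ._≤ D) (sym (degP-allZero q≡0)) ℕ.z≤n
degP-∷ (ℕ.s≤s deg≤) | no _ = deg≤

evalP/t^D⟶coeff : ∀ p D → degP p ℕ.≤ D → (λ t → (1/′ fromℕ t) ^ D * evalP p t) ⟶ fromℤ (coeff p D)
evalP/t^D⟶coeff []      D       _     = ⟶-cong {ℓ = 0ℚ} (always (λ t → sym (*-zeroʳ ((1/′ fromℕ t) ^ D))))
                                                 (⟶-const 0ℚ)
evalP/t^D⟶coeff (c ∷ q) zero    deg≤0 with all? (ℤ._≟ + 0) q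
... | no _    = ⊥-elim (ℕ.1+n≰n (ℕ.≤-trans deg≤0 ℕ.z≤n))
... | yes q≡0 = ⟶-cong (always constant) (⟶-const (fromℤ c))
  where
  constant : ∀ t → fromℤ c ≡ 1ℚ * evalP (c ∷ q) t
  constant t = sym (begin
    1ℚ * (fromℤ c + fromℕ t * evalP q t)  ≡⟨ *-identityˡ _ ⟩
    fromℤ c + fromℕ t * evalP q t         ≡⟨ cong (λ z → fromℤ c + fromℕ t * z) (evalP-allZero q≡0 t) ⟩
    fromℤ c + fromℕ t * 0ℚ                ≡⟨ cong (λ z → fromℤ c + z) (*-zeroʳ (fromℕ t)) ⟩
    fromℤ c + 0ℚ                          ≡⟨ +-identityʳ (fromℤ c) ⟩
    fromℤ c                               ∎)
    where open ≡-Reasoning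
evalP/t^D⟶coeff (c ∷ q) (suc D) deg≤ =
  ⟶-cong (eventually-map recombine (eventually-≥ 1))
    (subst (λ ℓ → (λ t → fromℤ c * u t * u t ^ D + u t ^ D * evalP q t) ⟶ ℓ)
      (limit-value (fromℤ c) (0ℚ ^ D) (fromℤ (coeff q D)))
      (⟶-+ {λ t → fromℤ c * u t * u t ^ D} {λ t → u t ^ D * evalP q t}
        (⟶-* {λ t → fromℤ c * u t} {λ t → u t ^ D}
          (⟶-* {λ _ → fromℤ c} {u} (⟶-const (fromℤ c)) 1/′fromℕ⟶0) (⟶-^ {u} D 1/′fromℕ⟶0))
        (evalP/t^D⟶coeff q D (degP-∷ {c} {q} deg≤))))
  where
  u : ℕ → ℚ
  u t = 1/′ fromℕ t
  limit-value : ∀ c p x → c * 0ℚ * p + x ≡ x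
  limit-value = solve-∀ ℚ-ring
  regroup : ∀ c u p x e → c * u * p + (x * u) * (p * e) ≡ (u * p) * (c + x * e)
  regroup = solve-∀ ℚ-ring
  recombine : ∀ {t} → 1 ℕ.≤ t →
              fromℤ c * u t * u t ^ D + u t ^ D * evalP q t ≡ u t ^ suc D * evalP (c ∷ q) t
  recombine {t} 1≤t = begin
    fromℤ c * u t * u t ^ D + u t ^ D * evalP q t
      ≡⟨ cong (λ z → fromℤ c * u t * u t ^ D + z) (*-identityˡ (u t ^ D * evalP q t)) ⟨
    fromℤ c * u t * u t ^ D + 1ℚ * (u t ^ D * evalP q t)
      ≡⟨ cong (λ z → fromℤ c * u t * u t ^ D + z * (u t ^ D * evalP q t)) (*-1/′-inverseʳ (pos⇒≢0 (fromℕ-pos 1≤t))) ⟨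
    fromℤ c * u t * u t ^ D + (fromℕ t * u t) * (u t ^ D * evalP q t)
      ≡⟨ regroup (fromℤ c) (u t) (u t ^ D) (fromℕ t) (evalP q t) ⟩
    (u t * u t ^ D) * (fromℤ c + fromℕ t * evalP q t)
      ∎
    where open ≡-Reasoning

pilotℚ : ∀ {m} → PVec m → Vec ℚ m
pilotℚ f = toℚV (pilot f)

normalised : ∀ {m} → PVec m → ℕ → Vec ℚ m
normalised f t = scale ((1/′ fromℕ t) ^ deg f) (evalV f t)

degP≤deg : ∀ {k} (f : Vec Poly k) → VecAll.All (λ p → degP p ℕ.≤ deg f) f
degP≤deg []      = VecAll.[]
degP≤deg (p ∷ f) =
  ℕ.m≤m⊔n (degP p) (deg f) VecAll.∷ VecAll.map (λ le → ℕ.≤-trans le (ℕ.m≤n⊔m (degP p) (deg f))) (degP≤deg f)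

evalV/t^D⟶coeffs : ∀ {k} (f : Vec Poly k) D → VecAll.All (λ p → degP p ℕ.≤ D) f →
                   (λ t → scale ((1/′ fromℕ t) ^ D) (evalV f t)) ⟶ⱽ toℚV (Vec.map (λ p → coeff p D) f)
evalV/t^D⟶coeffs []      D VecAll.[]              = _
evalV/t^D⟶coeffs (p ∷ f) D (deg≤ VecAll.∷ degs≤) = evalP/t^D⟶coeff p D deg≤ , evalV/t^D⟶coeffs f D degs≤

normalised⟶pilot : ∀ {m} (f : PVec m) → normalised f ⟶ⱽ pilotℚ f
normalised⟶pilot f = evalV/t^D⟶coeffs f (deg f) (degP≤deg f)

evalV≡scale-normalised : ∀ {m} (f : PVec m) {t} → 1 ℕ.≤ t →
                         evalV f t ≡ scale (fromℕ t ^ deg f) (normalised f t)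
evalV≡scale-normalised f {t} 1≤t = sym (begin
  scale (fromℕ t ^ deg f) (scale ((1/′ fromℕ t) ^ deg f) (evalV f t))
    ≡⟨ scale-scale (fromℕ t ^ deg f) ((1/′ fromℕ t) ^ deg f) (evalV f t) ⟩
  scale (fromℕ t ^ deg f * (1/′ fromℕ t) ^ deg f) (evalV f t)
    ≡⟨ cong (λ c → scale c (evalV f t)) (^-inverse (deg f) (*-1/′-inverseʳ (pos⇒≢0 (fromℕ-pos 1≤t)))) ⟩
  scale 1ℚ (evalV f t)
    ≡⟨ scale-one (evalV f t) ⟩
  evalV f t
    ∎)
  where open ≡-Reasoning

-- Gram–Schmidt and Lovász values

-- The σs are the Gram–Schmidt vectors computed so far, newest first.
lovValsFrom : ∀ {m} → List (Vec ℚ m) → List (Vec ℚ m) → List ℚ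
lovValsFrom σs       []       = []
lovValsFrom []       (h ∷ hs) = lovValsFrom (h ∷ []) hs
lovValsFrom (σ ∷ σs) (h ∷ hs) =
  lovVal σ (reduce (σ ∷ σs) h) h ∷ lovValsFrom (reduce (σ ∷ σs) h ∷ σ ∷ σs) hs

lovGo-gsAux : ∀ {m} (σs : List (Vec ℚ m)) h hs →
              lovGo (gsAux σs (h ∷ hs)) (h ∷ hs) ≡ lovValsFrom (reduce σs h ∷ σs) hs
lovGo-gsAux σs h []        = refl
lovGo-gsAux σs h (h′ ∷ hs) = cong (_ ∷_) (lovGo-gsAux (reduce σs h ∷ σs) h′ hs)

lovVals≡lovValsFrom[] : ∀ {m} (hs : List (Vec ℚ m)) → lovVals hs ≡ lovValsFrom [] hs
lovVals≡lovValsFrom[] []       = refl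
lovVals≡lovValsFrom[] (h ∷ hs) = lovGo-gsAux [] h hs

NonNullFrom : ∀ {m} → List (Vec ℚ m) → List (Vec ℚ m) → Set
NonNullFrom σs []       = ⊤
NonNullFrom σs (h ∷ hs) = NonNull (reduce σs h) × NonNullFrom (reduce σs h ∷ σs) hs

dot-self-pos : ∀ {m} (v : Vec ℚ m) → NonNull v → 0ℚ < dot v v
dot-self-pos v v≢0 with dot v v ≤? 0ℚ
... | yes vv≤0 = ⊥-elim (v≢0 (≤-antisym vv≤0 (dot-self-nonNeg v)))
... | no vv≰0  = ≰⇒> vv≰0

lovVal-pos : ∀ {m} (σ σ′ h : Vec ℚ m) → NonNull σ → NonNull σ′ → 0ℚ < lovVal σ σ′ h
lovVal-pos σ σ′ h σ≢0 σ′≢0 = <-≤-trans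
  (subst (0ℚ <_) (sym (/′-≡-*1/′ (dot σ′ σ′) (dot σ σ)))
         (*-pos (dot-self-pos σ′ σ′≢0) (1/′-pos (dot-self-pos σ σ≢0))))
  (subst (_≤ lovVal σ σ′ h) (+-identityʳ _) (+-monoʳ-≤ (dot σ′ σ′ /′ dot σ σ) (x*x≥0 (dot h σ /′ dot σ σ))))

lovValsFrom-pos : ∀ {m} (σs hs : List (Vec ℚ m)) → All NonNull σs → NonNullFrom σs hs →
                  All (0ℚ <_) (lovValsFrom σs hs)
lovValsFrom-pos σs       []       _            _                = []
lovValsFrom-pos []       (h ∷ hs) []           (h≢0 , nonNull)  = lovValsFrom-pos (h ∷ []) hs (h≢0 ∷ []) nonNull
lovValsFrom-pos (σ ∷ σs) (h ∷ hs) (σ≢0 ∷ σs≢0) (σ′≢0 , nonNull) =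
  lovVal-pos σ (reduce (σ ∷ σs) h) h σ≢0 σ′≢0 ∷
  lovValsFrom-pos (reduce (σ ∷ σs) h ∷ σ ∷ σs) hs (σ′≢0 ∷ σ≢0 ∷ σs≢0) nonNull

-- Linear independence

lincombL : ∀ {m} → List ℚ → List (Vec ℚ m) → Vec ℚ m
lincombL []       _        = zeroV
lincombL (c ∷ cs) []       = zeroV
lincombL (c ∷ cs) (v ∷ vs) = vadd (scale c v) (lincombL cs vs)

LinIndepList : ∀ {m} → List (Vec ℚ m) → Set
LinIndepList vs = ∀ cs → List.length cs ≡ List.length vs → lincombL cs vs ≡ zeroV → All (_≡ 0ℚ) cs

zeros : ℕ → List ℚ
zeros n = List.replicate n 0ℚ

lincombL-zeros : ∀ {m} (vs : List (Vec ℚ m)) → lincombL (zeros (List.length vs)) vs ≡ zeroV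
lincombL-zeros []       = refl
lincombL-zeros (v ∷ vs) = trans (cong₂ vadd (scale-zero v) (lincombL-zeros vs)) (vadd-identityˡ zeroV)

lincombL-+ : ∀ {m} cs ds (vs : List (Vec ℚ m)) →
             List.length cs ≡ List.length vs → List.length ds ≡ List.length vs →
             lincombL (List.zipWith _+_ cs ds) vs ≡ vadd (lincombL cs vs) (lincombL ds vs)
lincombL-+ []       []       []       _    _    = sym (vadd-identityˡ zeroV)
lincombL-+ (c ∷ cs) (d ∷ ds) (v ∷ vs) ∣cs∣ ∣ds∣ = trans
  (cong₂ vadd (scale-+ c d v) (lincombL-+ cs ds vs (ℕ.suc-injective ∣cs∣) (ℕ.suc-injective ∣ds∣)))
  (vadd-interchange (scale c v) (scale d v) (lincombL cs vs) (lincombL ds vs))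

lincombL-scale : ∀ {m} a cs (vs : List (Vec ℚ m)) →
                 lincombL (List.map (a *_) cs) vs ≡ scale a (lincombL cs vs)
lincombL-scale a []       vs       = sym (scale-zeroV a)
lincombL-scale a (c ∷ cs) []       = sym (scale-zeroV a)
lincombL-scale a (c ∷ cs) (v ∷ vs) =
  trans (cong₂ vadd (sym (scale-scale a c v)) (lincombL-scale a cs vs)) (sym (scale-vadd a (scale c v) _))

lincombL-++ : ∀ {m} cs ds (us vs : List (Vec ℚ m)) → List.length cs ≡ List.length us →
              lincombL (cs ++ ds) (us ++ vs) ≡ vadd (lincombL cs us) (lincombL ds vs)
lincombL-++ []       ds []       vs _    = sym (vadd-identityˡ _)
lincombL-++ (c ∷ cs) ds (u ∷ us) vs ∣cs∣ =
  trans (cong (vadd (scale c u)) (lincombL-++ cs ds us vs (ℕ.suc-injective ∣cs∣)))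
        (sym (vadd-assoc (scale c u) (lincombL cs us) (lincombL ds vs)))

data Span {m} (vs : List (Vec ℚ m)) : Vec ℚ m → Set where
  span-∈     : ∀ {v} → v ∈ vs → Span vs v
  span-zeroV : Span vs zeroV
  span-vadd  : ∀ {u v} → Span vs u → Span vs v → Span vs (vadd u v)
  span-scale : ∀ {v} a → Span vs v → Span vs (scale a v)

span-mono : ∀ {m} {us vs : List (Vec ℚ m)} {w} → (∀ {v} → v ∈ us → v ∈ vs) → Span us w → Span vs w
span-mono ∈⇒∈ (span-∈ v∈us)     = span-∈ (∈⇒∈ v∈us)
span-mono ∈⇒∈ span-zeroV        = span-zeroV
span-mono ∈⇒∈ (span-vadd su sv) = span-vadd (span-mono ∈⇒∈ su) (span-mono ∈⇒∈ sv)
span-mono ∈⇒∈ (span-scale a sv) = span-scale a (span-mono ∈⇒∈ sv)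

Coefficients : ∀ {m} → List (Vec ℚ m) → Vec ℚ m → Set
Coefficients vs w = ∃[ cs ] List.length cs ≡ List.length vs × lincombL cs vs ≡ w

∈⇒coefficients : ∀ {m} {vs : List (Vec ℚ m)} {v} → v ∈ vs → Coefficients vs v
∈⇒coefficients {vs = v ∷ vs} (here refl) =
  1ℚ ∷ zeros (List.length vs) , cong suc (List.length-replicate _) ,
  trans (cong₂ vadd (scale-one v) (lincombL-zeros vs)) (vadd-identityʳ v)
∈⇒coefficients {vs = u ∷ vs} (there v∈vs) with ∈⇒coefficients v∈vs
... | cs , ∣cs∣ , cs·vs≡v =
  0ℚ ∷ cs , cong suc ∣cs∣ , trans (cong₂ vadd (scale-zero u) cs·vs≡v) (vadd-identityˡ _)

span⇒coefficients : ∀ {m} {vs : List (Vec ℚ m)} {w} → Span vs w → Coefficients vs w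
span⇒coefficients (span-∈ v∈vs) = ∈⇒coefficients v∈vs
span⇒coefficients {vs = vs} span-zeroV = zeros (List.length vs) , List.length-replicate _ , lincombL-zeros vs
span⇒coefficients {vs = vs} (span-vadd su sv) with span⇒coefficients su | span⇒coefficients sv
... | cs , ∣cs∣ , cs·vs≡u | ds , ∣ds∣ , ds·vs≡v =
  List.zipWith _+_ cs ds ,
  trans (List.length-zipWith _+_ cs ds) (trans (cong₂ ℕ._⊓_ ∣cs∣ ∣ds∣) (ℕ.⊓-idem _)) ,
  trans (lincombL-+ cs ds vs ∣cs∣ ∣ds∣) (cong₂ vadd cs·vs≡u ds·vs≡v)
span⇒coefficients {vs = vs} (span-scale a sv) with span⇒coefficients sv
... | cs , ∣cs∣ , cs·vs≡v =
  List.map (a *_) cs , trans (List.length-map _ cs) ∣cs∣ , trans (lincombL-scale a cs vs) (cong (scale a) cs·vs≡v)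

linIndep⇒∉span : ∀ {m} (pre : List (Vec ℚ m)) h hs → LinIndepList (pre ++ h ∷ hs) → ¬ Span pre h
linIndep⇒∉span pre h hs indep h∈span with span⇒coefficients h∈span
... | cs , ∣cs∣ , cs·pre≡h = -1≢0 (All.head (All.++⁻ʳ cs (indep ks ∣ks∣ ks·vs≡0)))
  where
  open ≡-Reasoning
  -1≢0 : - 1ℚ ≢ 0ℚ
  -1≢0 ()
  ks = cs ++ - 1ℚ ∷ zeros (List.length hs)
  ∣ks∣ : List.length ks ≡ List.length (pre ++ h ∷ hs)
  ∣ks∣ = trans (List.length-++ cs)
               (trans (cong₂ ℕ._+_ ∣cs∣ (cong suc (List.length-replicate _))) (sym (List.length-++ pre)))
  ks·vs≡0 : lincombL ks (pre ++ h ∷ hs) ≡ zeroV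
  ks·vs≡0 = begin
    lincombL ks (pre ++ h ∷ hs)
      ≡⟨ lincombL-++ cs _ pre (h ∷ hs) ∣cs∣ ⟩
    vadd (lincombL cs pre) (vadd (scale (- 1ℚ) h) (lincombL (zeros (List.length hs)) hs))
      ≡⟨ cong₂ (λ u w → vadd u (vadd (scale (- 1ℚ) h) w)) cs·pre≡h (lincombL-zeros hs) ⟩
    vadd h (vadd (scale (- 1ℚ) h) zeroV)
      ≡⟨ cong (vadd h) (vadd-identityʳ _) ⟩
    vadd h (scale (- 1ℚ) h)
      ≡⟨ vadd-inverseʳ h ⟩
    zeroV
      ∎

reduce-∈-span : ∀ {m} (pre σs : List (Vec ℚ m)) h → All (Span pre) σs →
                ∃[ w ] Span pre w × reduce σs h ≡ vsub h w
reduce-∈-span pre []       h []                 = zeroV , span-zeroV , sym (vsub-zeroV h)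
reduce-∈-span pre (σ ∷ σs) h (σ∈span ∷ σs∈span) with reduce-∈-span pre σs h σs∈span
... | w , w∈span , eq = vadd w (scale a σ) , span-vadd w∈span (span-scale a σ∈span) ,
                        trans (cong (λ z → vsub z (scale a σ)) eq) (vsub-vsub h w (scale a σ))
  where a = dot h σ /′ dot σ σ

linIndep⇒nonNullFrom : ∀ {m} (pre σs hs : List (Vec ℚ m)) → All (Span pre) σs → LinIndepList (pre ++ hs) →
                       NonNullFrom σs hs
linIndep⇒nonNullFrom pre σs []       _       _     = _
linIndep⇒nonNullFrom pre σs (h ∷ hs) σs∈span indep with reduce-∈-span pre σs h σs∈span
... | w , w∈span , σ′≡h-w =
  σ′≢0 ,
  linIndep⇒nonNullFrom (pre ++ h ∷ []) (reduce σs h ∷ σs) hs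
    (σ′∈span ∷ All.map (span-mono ∈-++⁺ˡ) σs∈span) (subst LinIndepList (sym (List.++-assoc pre (h ∷ []) hs)) indep)
  where
  σ′≢0 : NonNull (reduce σs h)
  σ′≢0 σ′σ′≡0 = linIndep⇒∉span pre h hs indep
    (subst (Span pre) (sym (vsub≡zeroV⇒≡ h w (trans (sym σ′≡h-w) (dot-self≡0⇒≡zeroV _ σ′σ′≡0)))) w∈span)
  σ′∈span : Span (pre ++ h ∷ []) (reduce σs h)
  σ′∈span = subst (Span _) (sym (trans σ′≡h-w (vsub≡vadd-neg h w)))
    (span-vadd (span-∈ (∈-++⁺ʳ pre (here refl))) (span-scale (- 1ℚ) (span-mono ∈-++⁺ˡ w∈span)))

pad : ∀ {A : Set} {xs ys : List A} → xs ⊆ ys → List ℚ → List ℚ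
pad []       cs       = []
pad (y ∷ʳ s) cs       = 0ℚ ∷ pad s cs
pad (_ ∷ s)  []       = []
pad (_ ∷ s)  (c ∷ cs) = c ∷ pad s cs

length-pad : ∀ {A : Set} {xs ys : List A} (s : xs ⊆ ys) cs →
             List.length cs ≡ List.length xs → List.length (pad s cs) ≡ List.length ys
length-pad []       []       _    = refl
length-pad (y ∷ʳ s) cs       ∣cs∣ = cong suc (length-pad s cs ∣cs∣)
length-pad (_ ∷ s)  (c ∷ cs) ∣cs∣ = cong suc (length-pad s cs (ℕ.suc-injective ∣cs∣))

lincombL-pad : ∀ {m} {us vs : List (Vec ℚ m)} (s : us ⊆ vs) cs → lincombL (pad s cs) vs ≡ lincombL cs us
lincombL-pad []         []       = refl
lincombL-pad []         (c ∷ cs) = refl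
lincombL-pad (v ∷ʳ s)   cs       = trans (cong₂ vadd (scale-zero v) (lincombL-pad s cs)) (vadd-identityˡ _)
lincombL-pad (refl ∷ s) []       = refl
lincombL-pad (refl ∷ s) (c ∷ cs) = cong (vadd _) (lincombL-pad s cs)

pad-zeros : ∀ {A : Set} {xs ys : List A} (s : xs ⊆ ys) cs → List.length cs ≡ List.length xs →
            All (_≡ 0ℚ) (pad s cs) → All (_≡ 0ℚ) cs
pad-zeros []       []       _    _             = []
pad-zeros (y ∷ʳ s) cs       ∣cs∣ (_ ∷ pad≡0)   = pad-zeros s cs ∣cs∣ pad≡0
pad-zeros (_ ∷ s)  (c ∷ cs) ∣cs∣ (c≡0 ∷ pad≡0) = c≡0 ∷ pad-zeros s cs (ℕ.suc-injective ∣cs∣) pad≡0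

linIndep-⊆ : ∀ {m} {us vs : List (Vec ℚ m)} → us ⊆ vs → LinIndepList vs → LinIndepList us
linIndep-⊆ s indep cs ∣cs∣ cs·us≡0 =
  pad-zeros s cs ∣cs∣ (indep (pad s cs) (length-pad s cs ∣cs∣) (trans (lincombL-pad s cs) cs·us≡0))

padToVec : ∀ {n} → List ℚ → Vec ℚ n
padToVec {zero}  _        = []
padToVec {suc n} []       = 0ℚ ∷ padToVec []
padToVec {suc n} (c ∷ cs) = c ∷ padToVec cs

lincomb-padToVec : ∀ {m n} cs (vs : Vec (Vec ℚ m) n) → List.length cs ≡ List.length (toList vs) →
                   lincomb (padToVec cs) vs ≡ lincombL cs (toList vs)
lincomb-padToVec []       []       _    = refl
lincomb-padToVec (c ∷ cs) (v ∷ vs) ∣cs∣ =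
  cong (vadd (scale c v)) (lincomb-padToVec cs vs (ℕ.suc-injective ∣cs∣))

padToVec≡0⇒zeros : ∀ {m n} cs (vs : Vec (Vec ℚ m) n) → List.length cs ≡ List.length (toList vs) →
                   padToVec cs ≡ Vec.replicate n 0ℚ → All (_≡ 0ℚ) cs
padToVec≡0⇒zeros []       []       _    _    = []
padToVec≡0⇒zeros (c ∷ cs) (v ∷ vs) ∣cs∣ cs≡0 =
  cong Vec.head cs≡0 ∷ padToVec≡0⇒zeros cs vs (ℕ.suc-injective ∣cs∣) (cong Vec.tail cs≡0)

linIndep⇒linIndepList : ∀ {m n} (vs : Vec (Vec ℚ m) n) → LinIndep vs → LinIndepList (toList vs)
linIndep⇒linIndepList vs indep cs ∣cs∣ cs·vs≡0 =
  padToVec≡0⇒zeros cs vs ∣cs∣ (indep (padToVec cs) (trans (lincomb-padToVec cs vs ∣cs∣) cs·vs≡0))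

-- Continuity of the Lovász values

at : ∀ {A : Set} → ℕ → List (ℕ → A) → List A
at t = List.map (λ S → S t)

reduceSeq : ∀ {m} → List (ℕ → Vec ℚ m) → (ℕ → Vec ℚ m) → ℕ → Vec ℚ m
reduceSeq Ss H t = reduce (at t Ss) (H t)

lovValsFromSeq : ∀ {m} → List (ℕ → Vec ℚ m) → List (ℕ → Vec ℚ m) → List (ℕ → ℚ)
lovValsFromSeq Ss       []       = []
lovValsFromSeq []       (H ∷ Hs) = lovValsFromSeq (H ∷ []) Hs
lovValsFromSeq (S ∷ Ss) (H ∷ Hs) =
  (λ t → lovVal (S t) (reduceSeq (S ∷ Ss) H t) (H t)) ∷ lovValsFromSeq (reduceSeq (S ∷ Ss) H ∷ S ∷ Ss) Hs

at-lovValsFromSeq : ∀ {m} (Ss Hs : List (ℕ → Vec ℚ m)) t →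
                    at t (lovValsFromSeq Ss Hs) ≡ lovValsFrom (at t Ss) (at t Hs)
at-lovValsFromSeq Ss       []       t = refl
at-lovValsFromSeq []       (H ∷ Hs) t = at-lovValsFromSeq (H ∷ []) Hs t
at-lovValsFromSeq (S ∷ Ss) (H ∷ Hs) t = cong (_ ∷_) (at-lovValsFromSeq (reduceSeq (S ∷ Ss) H ∷ S ∷ Ss) Hs t)

⟶-coefficient : ∀ {m} {H S : ℕ → Vec ℚ m} {h σ} → H ⟶ⱽ h → S ⟶ⱽ σ → NonNull σ →
                (λ t → dot (H t) (S t) /′ dot (S t) (S t)) ⟶ dot h σ /′ dot σ σ
⟶-coefficient {H = H} {S} H⟶h S⟶σ σ≢0 =
  ⟶-/′ {λ t → dot (H t) (S t)} {λ t → dot (S t) (S t)} (⟶-dot {s = H} H⟶h S⟶σ) (⟶-dot {s = S} S⟶σ S⟶σ) σ≢0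

⟶ⱽ-reduce : ∀ {m} {Ss : List (ℕ → Vec ℚ m)} {σs H h} →
            Pointwise _⟶ⱽ_ Ss σs → All NonNull σs → H ⟶ⱽ h → reduceSeq Ss H ⟶ⱽ reduce σs h
⟶ⱽ-reduce []                 []            H⟶h = H⟶h
⟶ⱽ-reduce {Ss = S ∷ Ss} {H = H} (S⟶σ ∷ Ss⟶σs) (σ≢0 ∷ σs≢0) H⟶h =
  ⟶ⱽ-vsub {s = reduceSeq Ss H} (⟶ⱽ-reduce Ss⟶σs σs≢0 H⟶h)
    (⟶ⱽ-scale {a = λ t → dot (H t) (S t) /′ dot (S t) (S t)} {s = S} (⟶-coefficient {H = H} H⟶h S⟶σ σ≢0) S⟶σ)

⟶-lovVal : ∀ {m} {S S′ H : ℕ → Vec ℚ m} {σ σ′ h} → S ⟶ⱽ σ → S′ ⟶ⱽ σ′ → H ⟶ⱽ h → NonNull σ →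
           (λ t → lovVal (S t) (S′ t) (H t)) ⟶ lovVal σ σ′ h
⟶-lovVal {S = S} {S′} {H} S⟶σ S′⟶σ′ H⟶h σ≢0 =
  ⟶-+ {λ t → dot (S′ t) (S′ t) /′ dot (S t) (S t)} {λ t → ρ t * ρ t}
    (⟶-/′ {λ t → dot (S′ t) (S′ t)} {λ t → dot (S t) (S t)}
      (⟶-dot {s = S′} S′⟶σ′ S′⟶σ′) (⟶-dot {s = S} S⟶σ S⟶σ) σ≢0)
    (⟶-* {ρ} {ρ} ρ⟶ ρ⟶)
  where
  ρ = λ t → dot (H t) (S t) /′ dot (S t) (S t)
  ρ⟶ = ⟶-coefficient {H = H} H⟶h S⟶σ σ≢0

⟶-lovValsFrom : ∀ {m} {Ss Hs : List (ℕ → Vec ℚ m)} {σs hs} →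
                Pointwise _⟶ⱽ_ Ss σs → All NonNull σs → Pointwise _⟶ⱽ_ Hs hs → NonNullFrom σs hs →
                Pointwise _⟶_ (lovValsFromSeq Ss Hs) (lovValsFrom σs hs)
⟶-lovValsFrom _ _ [] _ = []
⟶-lovValsFrom {Ss = []} {H ∷ Hs} {[]} [] [] (H⟶h ∷ Hs⟶hs) (h≢0 , nonNull) =
  ⟶-lovValsFrom {Ss = H ∷ []} (H⟶h ∷ []) (h≢0 ∷ []) Hs⟶hs nonNull
⟶-lovValsFrom {Ss = S ∷ Ss} {H ∷ Hs} {σ ∷ σs} (S⟶σ ∷ Ss⟶σs) (σ≢0 ∷ σs≢0) (H⟶h ∷ Hs⟶hs) (σ′≢0 , nonNull) =
  ⟶-lovVal {S = S} {reduceSeq (S ∷ Ss) H} {H} S⟶σ S′⟶σ′ H⟶h σ≢0 ∷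
  ⟶-lovValsFrom {Ss = reduceSeq (S ∷ Ss) H ∷ S ∷ Ss} (S′⟶σ′ ∷ S⟶σ ∷ Ss⟶σs) (σ′≢0 ∷ σ≢0 ∷ σs≢0) Hs⟶hs nonNull
  where
  S′⟶σ′ = ⟶ⱽ-reduce {Ss = S ∷ Ss} {H = H} (S⟶σ ∷ Ss⟶σs) (σ≢0 ∷ σs≢0) H⟶h

-- Rescaling

rescale : ℚ × ℚ → ℚ → ℚ
rescale (c₀ , c₁) ℓ = (c₁ /′ c₀) * (c₁ /′ c₀) * ℓ

rescale-same : ∀ {c} ℓ → c ≢ 0ℚ → rescale (c , c) ℓ ≡ ℓ
rescale-same {c} ℓ c≢0 = begin
  (c /′ c) * (c /′ c) * ℓ  ≡⟨ cong (λ r → r * r * ℓ) (trans (/′-≡-*1/′ c c) (*-1/′-inverseʳ c≢0)) ⟩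
  1ℚ * 1ℚ * ℓ              ≡⟨ *-identityˡ ℓ ⟩
  ℓ                        ∎
  where open ≡-Reasoning

dot-scale-quotient : ∀ {m} a b d (u v w : Vec ℚ m) →
  dot (scale a u) (scale b v) /′ dot (scale d w) (scale d w) ≡ a * b * dot u v * (1/′ d * 1/′ d * 1/′ dot w w)
dot-scale-quotient a b d u v w = begin
  dot (scale a u) (scale b v) /′ dot (scale d w) (scale d w)
    ≡⟨ cong₂ _/′_ (dot-scale-scale a b u v) (dot-scale-scale d d w w) ⟩
  (a * b * dot u v) /′ (d * d * dot w w)
    ≡⟨ /′-≡-*1/′ (a * b * dot u v) (d * d * dot w w) ⟩
  a * b * dot u v * 1/′ (d * d * dot w w)
    ≡⟨ cong (a * b * dot u v *_)
            (trans (1/′-distrib-* (d * d) (dot w w)) (cong (_* 1/′ dot w w) (1/′-distrib-* d d))) ⟩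
  a * b * dot u v * (1/′ d * 1/′ d * 1/′ dot w w)
    ∎
  where open ≡-Reasoning

reduce-coefficient-scale : ∀ {m} c d (h σ : Vec ℚ m) → d ≢ 0ℚ →
  (dot (scale c h) (scale d σ) /′ dot (scale d σ) (scale d σ)) * d ≡ c * (dot h σ /′ dot σ σ)
reduce-coefficient-scale c d h σ d≢0 = begin
  (dot (scale c h) (scale d σ) /′ dot (scale d σ) (scale d σ)) * d  ≡⟨ cong (_* d) (dot-scale-quotient c d d h σ σ) ⟩
  c * d * Z * (i * i * j) * d                                       ≡⟨ regroup c d Z i j ⟩
  c * (Z * j) * ((d * i) * (d * i))                                 ≡⟨ cong (λ r → c * (Z * j) * (r * r))
                                                                            (*-1/′-inverseʳ d≢0) ⟩
  c * (Z * j) * (1ℚ * 1ℚ)                                           ≡⟨ *-identityʳ (c * (Z * j)) ⟩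
  c * (Z * j)                                                       ≡⟨ cong (c *_) (/′-≡-*1/′ Z (dot σ σ)) ⟨
  c * (dot h σ /′ dot σ σ)                                          ∎
  where
  open ≡-Reasoning
  Z = dot h σ
  i = 1/′ d
  j = 1/′ dot σ σ
  regroup : ∀ c d Z i j → c * d * Z * (i * i * j) * d ≡ c * (Z * j) * ((d * i) * (d * i))
  regroup = solve-∀ ℚ-ring

scaleBy : ∀ {m} → ℚ × Vec ℚ m → Vec ℚ m
scaleBy (c , v) = scale c v

NonZeroScalar : ∀ {m} → ℚ × Vec ℚ m → Set
NonZeroScalar (c , _) = c ≢ 0ℚ

reduce-scale : ∀ {m} (Ps : List (ℚ × Vec ℚ m)) → All NonZeroScalar Ps → ∀ c h →
               reduce (List.map scaleBy Ps) (scale c h) ≡ scale c (reduce (List.map proj₂ Ps) h)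
reduce-scale []             []           c h = refl
reduce-scale ((d , σ) ∷ Ps) (d≢0 ∷ Ps≢0) c h = begin
  vsub (reduce (List.map scaleBy Ps) (scale c h)) (scale a (scale d σ))
    ≡⟨ cong₂ vsub (reduce-scale Ps Ps≢0 c h) (scale-scale a d σ) ⟩
  vsub (scale c R) (scale (a * d) σ)
    ≡⟨ cong (λ z → vsub (scale c R) (scale z σ)) (reduce-coefficient-scale c d h σ d≢0) ⟩
  vsub (scale c R) (scale (c * b) σ)
    ≡⟨ cong (vsub (scale c R)) (scale-scale c b σ) ⟨
  vsub (scale c R) (scale c (scale b σ))
    ≡⟨ scale-vsub c R (scale b σ) ⟨
  scale c (vsub R (scale b σ))
    ∎
  where
  open ≡-Reasoning
  a = dot (scale c h) (scale d σ) /′ dot (scale d σ) (scale d σ)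
  b = dot h σ /′ dot σ σ
  R = reduce (List.map proj₂ Ps) h

lovVal-scale : ∀ {m} d c (σ σ′ h : Vec ℚ m) → d ≢ 0ℚ →
               lovVal (scale d σ) (scale c σ′) (scale c h) ≡ rescale (d , c) (lovVal σ σ′ h)
lovVal-scale d c σ σ′ h d≢0 = begin
  lovVal (scale d σ) (scale c σ′) (scale c h)
    ≡⟨ cong₂ (λ a b → a + b * b) (dot-scale-quotient c c d σ′ σ′ σ) (dot-scale-quotient c d d h σ σ) ⟩
  c * c * X * (i * i * j) + (c * d * Z * (i * i * j)) * (c * d * Z * (i * i * j))
    ≡⟨ regroup c d X Z i j ⟩
  (c * i) * (c * i) * (X * j + (Z * j) * (Z * j) * ((d * i) * (d * i)))
    ≡⟨ cong (λ r → (c * i) * (c * i) * (X * j + (Z * j) * (Z * j) * (r * r))) (*-1/′-inverseʳ d≢0) ⟩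
  (c * i) * (c * i) * (X * j + (Z * j) * (Z * j) * (1ℚ * 1ℚ))
    ≡⟨ cong (λ z → (c * i) * (c * i) * (X * j + z)) (*-identityʳ ((Z * j) * (Z * j))) ⟩
  (c * i) * (c * i) * (X * j + (Z * j) * (Z * j))
    ≡⟨ cong₂ (λ r x → r * r * x) (/′-≡-*1/′ c d)
             (cong₂ (λ x z → x + z * z) (/′-≡-*1/′ X (dot σ σ)) (/′-≡-*1/′ Z (dot σ σ))) ⟨
  rescale (d , c) (lovVal σ σ′ h)
    ∎
  where
  open ≡-Reasoning
  X = dot σ′ σ′
  Z = dot h σ
  i = 1/′ d
  j = 1/′ dot σ σ
  regroup : ∀ c d X Z i j → c * c * X * (i * i * j) + (c * d * Z * (i * i * j)) * (c * d * Z * (i * i * j))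
                          ≡ (c * i) * (c * i) * (X * j + (Z * j) * (Z * j) * ((d * i) * (d * i)))
  regroup = solve-∀ ℚ-ring

adjacentPairsFrom : ∀ {A : Set} → Maybe A → List A → List (A × A)
adjacentPairsFrom _        []       = []
adjacentPairsFrom nothing  (y ∷ ys) = adjacentPairsFrom (just y) ys
adjacentPairsFrom (just x) (y ∷ ys) = (x , y) ∷ adjacentPairsFrom (just y) ys

adjacentPairs : ∀ {A : Set} → List A → List (A × A)
adjacentPairs = adjacentPairsFrom nothing

adjacentPairsFrom-map : ∀ {A B : Set} (f : A → B) mx xs →
  adjacentPairsFrom (Maybe.map f mx) (List.map f xs) ≡ List.map (Product.map f f) (adjacentPairsFrom mx xs)
adjacentPairsFrom-map f mx       []       = refl
adjacentPairsFrom-map f nothing  (x ∷ xs) = adjacentPairsFrom-map f (just x) xs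
adjacentPairsFrom-map f (just y) (x ∷ xs) = cong (_ ∷_) (adjacentPairsFrom-map f (just x) xs)

lovValsFrom-scale : ∀ {m} (Ps Qs : List (ℚ × Vec ℚ m)) → All NonZeroScalar Ps → All NonZeroScalar Qs →
  lovValsFrom (List.map scaleBy Ps) (List.map scaleBy Qs) ≡
  List.zipWith rescale (adjacentPairsFrom (List.head (List.map proj₁ Ps)) (List.map proj₁ Qs))
                       (lovValsFrom (List.map proj₂ Ps) (List.map proj₂ Qs))
lovValsFrom-scale Ps             []             _            _            = refl
lovValsFrom-scale []             ((c , h) ∷ Qs) []           (c≢0 ∷ Qs≢0) =
  lovValsFrom-scale ((c , h) ∷ []) Qs (c≢0 ∷ []) Qs≢0
lovValsFrom-scale ((d , σ) ∷ Ps) ((c , h) ∷ Qs) (d≢0 ∷ Ps≢0) (c≢0 ∷ Qs≢0) = trans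
  (cong (λ σ′ → lovVal (scale d σ) σ′ (scale c h) ∷ lovValsFrom (σ′ ∷ scale d σ ∷ List.map scaleBy Ps)
                                                                (List.map scaleBy Qs))
        (reduce-scale ((d , σ) ∷ Ps) (d≢0 ∷ Ps≢0) c h))
  (cong₂ _∷_ (lovVal-scale d c σ σ′ h d≢0)
             (lovValsFrom-scale ((c , σ′) ∷ (d , σ) ∷ Ps) Qs (c≢0 ∷ d≢0 ∷ Ps≢0) Qs≢0))
  where σ′ = reduce (σ ∷ List.map proj₂ Ps) h

reduce-scale-uniform : ∀ {m} c (σs : List (Vec ℚ m)) h → c ≢ 0ℚ →
                       reduce (List.map (scale c) σs) (scale c h) ≡ scale c (reduce σs h)
reduce-scale-uniform c σs h c≢0 = begin
  reduce (List.map (scale c) σs) (scale c h)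
    ≡⟨ cong (λ τs → reduce τs (scale c h)) (List.map-∘ σs) ⟩
  reduce (List.map scaleBy (List.map (c ,_) σs)) (scale c h)
    ≡⟨ reduce-scale (List.map (c ,_) σs) (All.map⁺ (All.universal (λ _ → c≢0) σs)) c h ⟩
  scale c (reduce (List.map proj₂ (List.map (c ,_) σs)) h)
    ≡⟨ cong (λ τs → scale c (reduce τs h)) (trans (sym (List.map-∘ σs)) (List.map-id σs)) ⟩
  scale c (reduce σs h)
    ∎
  where open ≡-Reasoning

lovValsFrom-scale-uniform : ∀ {m} c (σs hs : List (Vec ℚ m)) → c ≢ 0ℚ →
                            lovValsFrom (List.map (scale c) σs) (List.map (scale c) hs) ≡ lovValsFrom σs hs
lovValsFrom-scale-uniform c σs       []       c≢0 = refl
lovValsFrom-scale-uniform c []       (h ∷ hs) c≢0 = lovValsFrom-scale-uniform c (h ∷ []) hs c≢0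
lovValsFrom-scale-uniform c (σ ∷ σs) (h ∷ hs) c≢0 = trans
  (cong (λ σ′ → lovVal (scale c σ) σ′ (scale c h) ∷ lovValsFrom (σ′ ∷ scale c σ ∷ List.map (scale c) σs)
                                                                (List.map (scale c) hs))
        (reduce-scale-uniform c (σ ∷ σs) h c≢0))
  (cong₂ _∷_ (trans (lovVal-scale c c σ σ′ h c≢0) (rescale-same (lovVal σ σ′ h) c≢0))
             (lovValsFrom-scale-uniform c (σ′ ∷ σ ∷ σs) hs c≢0))
  where σ′ = reduce (σ ∷ σs) h

-- Degree blocks

reduce-orthogonal : ∀ {m} (x h : Vec ℚ m) σs → dot x h ≡ 0ℚ → All (λ σ → dot x σ ≡ 0ℚ) σs →
                    dot x (reduce σs h) ≡ 0ℚ
reduce-orthogonal x h []       x⊥h []           = x⊥h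
reduce-orthogonal x h (σ ∷ σs) x⊥h (x⊥σ ∷ x⊥σs) = begin
  dot x (vsub (reduce σs h) (scale a σ))   ≡⟨ dot-vsubʳ x (reduce σs h) (scale a σ) ⟩
  dot x (reduce σs h) - dot x (scale a σ)  ≡⟨ cong₂ _-_ (reduce-orthogonal x h σs x⊥h x⊥σs)
                                                        (trans (dot-scaleʳ a x σ) (cong (a *_) x⊥σ)) ⟩
  0ℚ - a * 0ℚ                              ≡⟨ cong (λ z → 0ℚ - z) (*-zeroʳ a) ⟩
  0ℚ                                       ∎
  where
  open ≡-Reasoning
  a = dot h σ /′ dot σ σ

vsub-projection-orthogonal : ∀ {m} (r h σ : Vec ℚ m) → dot h σ ≡ 0ℚ → vsub r (scale (dot h σ /′ dot σ σ) σ) ≡ r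
vsub-projection-orthogonal r h σ h⊥σ = begin
  vsub r (scale (dot h σ /′ dot σ σ) σ)  ≡⟨ cong (λ z → vsub r (scale (z /′ dot σ σ) σ)) h⊥σ ⟩
  vsub r (scale (0ℚ /′ dot σ σ) σ)       ≡⟨ cong (λ z → vsub r (scale z σ)) (trans (/′-≡-*1/′ 0ℚ (dot σ σ))
                                                                                   (*-zeroˡ (1/′ dot σ σ))) ⟩
  vsub r (scale 0ℚ σ)                    ≡⟨ cong (vsub r) (scale-zero σ) ⟩
  vsub r zeroV                           ≡⟨ vsub-zeroV r ⟩
  r                                      ∎
  where open ≡-Reasoning

lovValsFrom-∷ : ∀ {m} {P : ℚ → Set} (σs : List (Vec ℚ m)) h hs →
                All P (lovValsFrom σs (h ∷ hs)) → All P (lovValsFrom (reduce σs h ∷ σs) hs)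
lovValsFrom-∷ []       h hs Pℓs       = Pℓs
lovValsFrom-∷ (σ ∷ σs) h hs (_ ∷ Pℓs) = Pℓs

SameTagBound : ℚ → ℕ × ℕ → ℚ → Set
SameTagBound δ′ (d , e) ℓ = d ≡ e → δ′ ≤ ℓ

module Blocks {m : ℕ} {A : Set} (tag : A → ℕ) (vec : A → Vec ℚ m) where

  -- A Gram–Schmidt vector paired with the tag of the item it was computed from.
  TaggedStar : Set
  TaggedStar = ℕ × Vec ℚ m

  starsOf : ℕ → List TaggedStar → List (Vec ℚ m)
  starsOf d τs = List.map proj₂ (List.filter ((ℕ._≟ d) ∘ proj₁) τs)

  itemsOf : ℕ → List A → List A
  itemsOf d = List.filter ((ℕ._≟ d) ∘ tag)

  starsOf-accept : ∀ {d e} σ τs → e ≡ d → starsOf d ((e , σ) ∷ τs) ≡ σ ∷ starsOf d τs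
  starsOf-accept σ τs e≡d = cong (List.map proj₂) (List.filter-accept ((ℕ._≟ _) ∘ proj₁) e≡d)

  starsOf-reject : ∀ {d e} σ τs → e ≢ d → starsOf d ((e , σ) ∷ τs) ≡ starsOf d τs
  starsOf-reject σ τs e≢d = cong (List.map proj₂) (List.filter-reject ((ℕ._≟ _) ∘ proj₁) e≢d)

  itemsOf-accept : ∀ {d} f fs → tag f ≡ d → itemsOf d (f ∷ fs) ≡ f ∷ itemsOf d fs
  itemsOf-accept f fs tag≡d = List.filter-accept ((ℕ._≟ _) ∘ tag) tag≡d

  itemsOf-reject : ∀ {d} f fs → tag f ≢ d → itemsOf d (f ∷ fs) ≡ itemsOf d fs
  itemsOf-reject f fs tag≢d = List.filter-reject ((ℕ._≟ _) ∘ tag) tag≢d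

  OrthogonalAcrossTags : A → A → Set
  OrthogonalAcrossTags f g = tag f ≢ tag g → dot (vec f) (vec g) ≡ 0ℚ

  OrthogonalToStarsOfOtherTags : List TaggedStar → A → Set
  OrthogonalToStarsOfOtherTags τs g = All (λ (e , σ) → tag g ≢ e → dot (vec g) σ ≡ 0ℚ) τs

  BlockBounds : ℚ → List TaggedStar → List A → Set
  BlockBounds δ′ τs fs = ∀ d → All (δ′ ≤_) (lovValsFrom (starsOf d τs) (List.map vec (itemsOf d fs)))

  reduce-starsOf : ∀ d h τs → All (λ (e , σ) → e ≢ d → dot h σ ≡ 0ℚ) τs →
                   reduce (List.map proj₂ τs) h ≡ reduce (starsOf d τs) h
  reduce-starsOf d h []             []           = refl
  reduce-starsOf d h ((e , σ) ∷ τs) (h⊥σ ∷ h⊥τs) with e ℕ.≟ d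
  ... | yes e≡d = trans (cong (λ r → vsub r (scale (dot h σ /′ dot σ σ) σ)) (reduce-starsOf d h τs h⊥τs))
                        (cong (λ σs → reduce σs h) (sym (starsOf-accept σ τs e≡d)))
  ... | no e≢d  = begin
    vsub (reduce (List.map proj₂ τs) h) (scale (dot h σ /′ dot σ σ) σ)
      ≡⟨ vsub-projection-orthogonal (reduce (List.map proj₂ τs) h) h σ (h⊥σ e≢d) ⟩
    reduce (List.map proj₂ τs) h
      ≡⟨ reduce-starsOf d h τs h⊥τs ⟩
    reduce (starsOf d τs) h
      ≡⟨ cong (λ σs → reduce σs h) (starsOf-reject σ τs e≢d) ⟨
    reduce (starsOf d ((e , σ) ∷ τs)) h
      ∎
    where open ≡-Reasoning

  reduce-own-block : ∀ τs f → OrthogonalToStarsOfOtherTags τs f →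
                     reduce (List.map proj₂ τs) (vec f) ≡ reduce (starsOf (tag f) τs) (vec f)
  reduce-own-block τs f f⊥τs =
    reduce-starsOf (tag f) (vec f) τs (All.map (λ f⊥σ e≢tag → f⊥σ (e≢tag ∘ sym)) f⊥τs)

  orthogonal-to-starsOf : ∀ {d} τs g → OrthogonalToStarsOfOtherTags τs g → tag g ≢ d →
                          All (λ σ → dot (vec g) σ ≡ 0ℚ) (starsOf d τs)
  orthogonal-to-starsOf     []             g []           tag≢d = []
  orthogonal-to-starsOf {d} ((e , σ) ∷ τs) g (g⊥σ ∷ g⊥τs) tag≢d with e ℕ.≟ d
  ... | yes e≡d = subst (All _) (sym (starsOf-accept σ τs e≡d))
                        (g⊥σ (λ tag≡e → tag≢d (trans tag≡e e≡d)) ∷ orthogonal-to-starsOf τs g g⊥τs tag≢d)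
  ... | no e≢d  = subst (All _) (sym (starsOf-reject σ τs e≢d)) (orthogonal-to-starsOf τs g g⊥τs tag≢d)

  orthogonality-step : ∀ τs f fs → All (OrthogonalAcrossTags f) fs →
                       All (OrthogonalToStarsOfOtherTags τs) (f ∷ fs) →
                       All (OrthogonalToStarsOfOtherTags ((tag f , reduce (List.map proj₂ τs) (vec f)) ∷ τs)) fs
  orthogonality-step τs f fs f⊥fs (f⊥τs ∷ fs⊥τs) =
    All.zipWith (λ (f⊥g , g⊥τs) → new-star g⊥τs f⊥g ∷ g⊥τs) (f⊥fs , fs⊥τs)
    where
    new-star : ∀ {g} → OrthogonalToStarsOfOtherTags τs g → OrthogonalAcrossTags f g →
               tag g ≢ tag f → dot (vec g) (reduce (List.map proj₂ τs) (vec f)) ≡ 0ℚ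
    new-star {g} g⊥τs f⊥g tag≢ = trans (cong (dot (vec g)) (reduce-own-block τs f f⊥τs))
      (reduce-orthogonal (vec g) (vec f) (starsOf (tag f) τs)
        (trans (dot-comm (vec g) (vec f)) (f⊥g (tag≢ ∘ sym))) (orthogonal-to-starsOf τs g g⊥τs tag≢))

  blockBounds-step : ∀ {δ′} τs f fs → OrthogonalToStarsOfOtherTags τs f → BlockBounds δ′ τs (f ∷ fs) →
                     BlockBounds δ′ ((tag f , reduce (List.map proj₂ τs) (vec f)) ∷ τs) fs
  blockBounds-step {δ′} τs f fs f⊥τs bounds d with tag f ℕ.≟ d
  ... | yes refl =
    subst (λ σs → All (δ′ ≤_) (lovValsFrom σs (List.map vec (itemsOf d fs))))
      (sym (trans (starsOf-accept _ τs refl) (cong (_∷ starsOf d τs) (reduce-own-block τs f f⊥τs))))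
      (lovValsFrom-∷ (starsOf d τs) (vec f) (List.map vec (itemsOf d fs))
        (subst (λ gs → All (δ′ ≤_) (lovValsFrom (starsOf d τs) (List.map vec gs))) (itemsOf-accept f fs refl)
          (bounds d)))
  ... | no tag≢d =
    subst₂ (λ σs gs → All (δ′ ≤_) (lovValsFrom σs (List.map vec gs)))
      (sym (starsOf-reject _ τs tag≢d)) (itemsOf-reject f fs tag≢d) (bounds d)

  sameTag-bound : ∀ {δ′} e σ τs f fs → OrthogonalToStarsOfOtherTags ((e , σ) ∷ τs) f →
                  BlockBounds δ′ ((e , σ) ∷ τs) (f ∷ fs) →
                  e ≡ tag f → δ′ ≤ lovVal σ (reduce (σ ∷ List.map proj₂ τs) (vec f)) (vec f)
  sameTag-bound {δ′} e σ τs f fs f⊥τs bounds refl =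
    subst (λ σ′ → δ′ ≤ lovVal σ σ′ (vec f)) (sym own-block)
      (All.head (subst₂ (λ σs gs → All (δ′ ≤_) (lovValsFrom σs (List.map vec gs)))
                  (starsOf-accept σ τs refl) (itemsOf-accept f fs refl) (bounds e)))
    where
    own-block : reduce (σ ∷ List.map proj₂ τs) (vec f) ≡ reduce (σ ∷ starsOf e τs) (vec f)
    own-block = trans (reduce-own-block ((e , σ) ∷ τs) f f⊥τs)
                      (cong (λ σs → reduce σs (vec f)) (starsOf-accept σ τs refl))

  sameTag-bounds : ∀ {δ′} τs fs → AllPairs OrthogonalAcrossTags fs → All (OrthogonalToStarsOfOtherTags τs) fs →
    BlockBounds δ′ τs fs →
    Pointwise (SameTagBound δ′) (adjacentPairsFrom (List.head (List.map proj₁ τs)) (List.map tag fs))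
                                (lovValsFrom (List.map proj₂ τs) (List.map vec fs))
  sameTag-bounds τs             []       _                 _               _      = []
  sameTag-bounds []             (f ∷ fs) (f⊥fs ∷ pairwise) fs⊥τs           bounds =
    sameTag-bounds ((tag f , vec f) ∷ []) fs pairwise
      (orthogonality-step [] f fs f⊥fs fs⊥τs) (blockBounds-step [] f fs [] bounds)
  sameTag-bounds ((e , σ) ∷ τs) (f ∷ fs) (f⊥fs ∷ pairwise) (f⊥τs ∷ fs⊥τs) bounds =
    sameTag-bound e σ τs f fs f⊥τs bounds ∷
    sameTag-bounds ((tag f , _) ∷ (e , σ) ∷ τs) fs pairwise
      (orthogonality-step ((e , σ) ∷ τs) f fs f⊥fs (f⊥τs ∷ fs⊥τs))
      (blockBounds-step ((e , σ) ∷ τs) f fs f⊥τs bounds)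

-- Lovász values of B(t)

powers : ℕ → ℕ × ℕ → ℚ × ℚ
powers t = Product.map (fromℕ t ^_) (fromℕ t ^_)

-- Between blocks the factor (t^b / t^a)² ≥ t outgrows every bound; inside a block it is 1.
rescaled-eventually-≥ : ∀ {φ ℓ δ δ′} a b → φ ⟶ ℓ → a ℕ.≤ b → SameTagBound δ′ (a , b) ℓ → 0ℚ < ℓ →
                        δ < δ′ → δ < 1ℚ → Eventually (λ t → δ ≤ rescale (powers t (a , b)) (φ t))
rescaled-eventually-≥ {φ} {ℓ} {δ} a b φ⟶ℓ a≤b sameTag ℓ>0 δ<δ′ δ<1 with a ℕ.≟ b
... | yes refl =
  eventually-map (λ (1≤t , δ≤φ) → subst (δ ≤_) (sym (rescale-same (φ _) (1≤x⇒x^n≢0 (fromℕ-≥1 1≤t) a))) δ≤φ)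
    (eventually-∧ (eventually-≥ 1) (⟶⇒eventually-≥ φ⟶ℓ (<-≤-trans δ<δ′ (sameTag refl))))
... | no a≢b = eventually-map bound
  (eventually-∧ (eventually-∧ (eventually-≥ 1) (archimedean (1/′ (ℓ * ½)))) (⟶⇒eventually-≥ φ⟶ℓ (p*½<p ℓ>0)))
  where
  open ≤-Reasoning
  k = b ℕ.∸ a
  b≡a+k : b ≡ a ℕ.+ k
  b≡a+k = sym (ℕ.m+[n∸m]≡n a≤b)
  k≢0 : k ≢ 0
  k≢0 k≡0 = a≢b (trans (sym (ℕ.+-identityʳ a)) (trans (cong (a ℕ.+_) (sym k≡0)) (sym b≡a+k)))
  ½ℓ>0 = *-pos ℓ>0 ½-pos
  bound : ∀ {t} → (1 ℕ.≤ t × 1/′ (ℓ * ½) ≤ fromℕ t) × ℓ * ½ ≤ φ t → δ ≤ rescale (powers t (a , b)) (φ t)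
  bound {t} ((1≤t , large) , φ≥½ℓ) = begin
    δ                      ≤⟨ <⇒≤ δ<1 ⟩
    1ℚ                     ≡⟨ *-1/′-inverseʳ (pos⇒≢0 ½ℓ>0) ⟨
    ℓ * ½ * 1/′ (ℓ * ½)    ≡⟨ *-comm (ℓ * ½) (1/′ (ℓ * ½)) ⟩
    1/′ (ℓ * ½) * (ℓ * ½)  ≤⟨ *-mono-≤-nonNeg (<⇒≤ (1/′-pos ½ℓ>0)) (<⇒≤ ½ℓ>0) large φ≥½ℓ ⟩
    x * φ t                ≤⟨ *-monoʳ-≤-nonNeg (φ t) {{nonNegative (≤-trans (<⇒≤ ½ℓ>0) φ≥½ℓ)}} x≤r*r ⟩
    r * r * φ t            ∎
    where
    x = fromℕ t
    1≤x = fromℕ-≥1 1≤t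
    r = (x ^ b) /′ (x ^ a)
    x≤r : x ≤ r
    x≤r = subst (x ≤_) (sym (trans (cong (λ n → (x ^ n) /′ (x ^ a)) b≡a+k)
                                   (x^[a+k]/′x^a≡x^k a k (1≤x⇒x^n≢0 1≤x a))))
                       (subst (λ n → x ≤ x ^ n) (ℕ.suc-pred k {{ℕ.≢-nonZero k≢0}}) (1≤x⇒x≤x^[1+n] 1≤x (ℕ.pred k)))
    x≤r*r : x ≤ r * r
    x≤r*r = subst (_≤ r * r) (*-identityʳ x)
      (*-mono-≤-nonNeg (≤-trans (nonNegative⁻¹ 1ℚ) 1≤x) (nonNegative⁻¹ 1ℚ) x≤r (≤-trans 1≤x x≤r))

all-rescaled-eventually-≥ : ∀ {δ δ′} {Φ : List (ℕ → ℚ)} {ℓs} {DP : List (ℕ × ℕ)} →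
  Pointwise _⟶_ Φ ℓs → Pointwise (SameTagBound δ′) DP ℓs → All (0ℚ <_) ℓs → All (λ (a , b) → a ℕ.≤ b) DP →
  δ < δ′ → δ < 1ℚ → Eventually (λ t → All (δ ≤_) (List.zipWith rescale (List.map (powers t) DP) (at t Φ)))
all-rescaled-eventually-≥ [] [] [] [] δ<δ′ δ<1 = always (λ _ → [])
all-rescaled-eventually-≥ {Φ = φ ∷ Φ} {DP = (a , b) ∷ DP}
  (φ⟶ ∷ Φ⟶) (sameTag ∷ sameTags) (ℓ>0 ∷ ℓs>0) (a≤b ∷ as≤bs) δ<δ′ δ<1 =
  eventually-map (λ (head , tail) → head ∷ tail)
    (eventually-∧ (rescaled-eventually-≥ {φ} a b φ⟶ a≤b sameTag ℓ>0 δ<δ′ δ<1)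
                  (all-rescaled-eventually-≥ Φ⟶ sameTags ℓs>0 as≤bs δ<δ′ δ<1))

⟶-nth-≥ : ∀ {δ′} (Φ : List (ℕ → ℚ)) {ℓs} → Pointwise _⟶_ Φ ℓs →
          (∀ i ε → 0ℚ < ε → Eventually (λ t → ∀ q → nth (at t Φ) i ≡ just q → δ′ - ε ≤ q)) →
          All (δ′ ≤_) ℓs
⟶-nth-≥ []      []           _     = []
⟶-nth-≥ (φ ∷ Φ) (φ⟶ℓ ∷ Φ⟶ℓs) above =
  ⟶-≥ φ⟶ℓ (λ ε ε>0 → eventually-map (λ above₀ → above₀ (φ _) refl) (above 0 ε ε>0)) ∷
  ⟶-nth-≥ Φ Φ⟶ℓs (above ∘ suc)

⟶ⱽ-normalised : ∀ {m} (L : List (PVec m)) → Pointwise _⟶ⱽ_ (List.map normalised L) (List.map pilotℚ L)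
⟶ⱽ-normalised []      = []
⟶ⱽ-normalised (f ∷ L) = normalised⟶pilot f ∷ ⟶ⱽ-normalised L

evalL≡scaled-normalised : ∀ {m} (L : List (PVec m)) {t} → 1 ℕ.≤ t →
                          evalL L t ≡ List.map scaleBy (List.map (λ f → fromℕ t ^ deg f , normalised f t) L)
evalL≡scaled-normalised []      1≤t = refl
evalL≡scaled-normalised (f ∷ L) 1≤t = cong₂ _∷_ (evalV≡scale-normalised f 1≤t) (evalL≡scaled-normalised L 1≤t)

lovVals-evalL : ∀ {m} (L : List (PVec m)) {t} → 1 ℕ.≤ t →
  lovVals (evalL L t) ≡
  List.zipWith rescale (List.map (powers t) (adjacentPairs (List.map deg L)))
                       (at t (lovValsFromSeq [] (List.map normalised L)))
lovVals-evalL L {t} 1≤t = begin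
  lovVals (evalL L t)
    ≡⟨ lovVals≡lovValsFrom[] (evalL L t) ⟩
  lovValsFrom [] (evalL L t)
    ≡⟨ cong (lovValsFrom []) (evalL≡scaled-normalised L 1≤t) ⟩
  lovValsFrom [] (List.map scaleBy Ps)
    ≡⟨ lovValsFrom-scale [] Ps [] (All.map⁺ (All.tabulate (λ {f} _ → 1≤x⇒x^n≢0 (fromℕ-≥1 1≤t) (deg f)))) ⟩
  List.zipWith rescale (adjacentPairs (List.map proj₁ Ps)) (lovValsFrom [] (List.map proj₂ Ps))
    ≡⟨ cong₂ (List.zipWith rescale) scalars vectors ⟩
  List.zipWith rescale (List.map (powers t) (adjacentPairs (List.map deg L)))
                       (at t (lovValsFromSeq [] (List.map normalised L)))
    ∎
  where
  open ≡-Reasoning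
  Ps = List.map (λ f → fromℕ t ^ deg f , normalised f t) L
  scalars : adjacentPairs (List.map proj₁ Ps) ≡ List.map (powers t) (adjacentPairs (List.map deg L))
  scalars = trans (cong adjacentPairs (trans (sym (List.map-∘ L)) (List.map-∘ L)))
                  (adjacentPairsFrom-map (fromℕ t ^_) nothing (List.map deg L))
  vectors : lovValsFrom [] (List.map proj₂ Ps) ≡ at t (lovValsFromSeq [] (List.map normalised L))
  vectors = trans (cong (lovValsFrom []) (trans (sym (List.map-∘ L)) (List.map-∘ L)))
                  (sym (at-lovValsFromSeq [] (List.map normalised L) t))

lovVals-evalL-block : ∀ {m} (L : List (PVec m)) d {t} → 1 ℕ.≤ t → All (λ f → deg f ≡ d) L →
                      lovVals (evalL L t) ≡ at t (lovValsFromSeq [] (List.map normalised L))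
lovVals-evalL-block L d {t} 1≤t degs≡d = begin
  lovVals (evalL L t)                                        ≡⟨ lovVals≡lovValsFrom[] (evalL L t) ⟩
  lovValsFrom [] (evalL L t)                                 ≡⟨ cong (lovValsFrom []) (evalL≡scaled L degs≡d) ⟩
  lovValsFrom [] (List.map (scale (fromℕ t ^ d)) (at t Ns))  ≡⟨ lovValsFrom-scale-uniform (fromℕ t ^ d) [] (at t Ns)
                                                                  (1≤x⇒x^n≢0 (fromℕ-≥1 1≤t) d) ⟩
  lovValsFrom [] (at t Ns)                                   ≡⟨ at-lovValsFromSeq [] Ns t ⟨
  at t (lovValsFromSeq [] Ns)                                ∎
  where
  open ≡-Reasoning
  Ns = List.map normalised L
  evalL≡scaled : ∀ L → All (λ f → deg f ≡ d) L →
                 evalL L t ≡ List.map (scale (fromℕ t ^ d)) (at t (List.map normalised L))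
  evalL≡scaled []      []              = refl
  evalL≡scaled (f ∷ L) (refl ∷ degs≡d) = cong₂ _∷_ (evalV≡scale-normalised f 1≤t) (evalL≡scaled L degs≡d)

All-toList : ∀ {A : Set} {P : A → Set} {n} (xs : Vec A n) → (∀ i → P (Vec.lookup xs i)) → All P (toList xs)
All-toList []       P[xs] = []
All-toList (x ∷ xs) P[xs] = P[xs] zero ∷ All-toList xs (P[xs] ∘ suc)

asymOrth⇒allPairs : ∀ {m n} (B : Vec (PVec m) n) → AsymOrthDegrees B →
                    AllPairs (Blocks.OrthogonalAcrossTags deg pilotℚ) (toList B)
asymOrth⇒allPairs []      _    = []
asymOrth⇒allPairs (f ∷ B) orth =
  All-toList B (λ j deg≢ → trans (dot-toℚV (pilot f) _) (cong fromℤ (orth zero (suc j) deg≢))) ∷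
  asymOrth⇒allPairs B (λ i j → orth (suc i) (suc j))

sorted⇒adjacent-≤ : ∀ {m n} (B : Vec (PVec m) n) → SortedByDeg B →
                    All (λ (a , b) → a ℕ.≤ b) (adjacentPairs (List.map deg (toList B)))
sorted⇒adjacent-≤ []      _      = []
sorted⇒adjacent-≤ (f ∷ B) sorted = after f B sorted
  where
  after : ∀ {n} f (B : Vec (PVec _) n) → SortedByDeg (f ∷ B) →
          All (λ (a , b) → a ℕ.≤ b) (adjacentPairsFrom (just (deg f)) (List.map deg (toList B)))
  after f []      _      = []
  after f (g ∷ B) sorted =
    sorted zero (suc zero) ℕ.z≤n ∷ after g B (λ i j i≤j → sorted (suc i) (suc j) (ℕ.s≤s i≤j))

lemma3p20 : ∀ {m n : ℕ} (B : Vec (PVec m) n) (δ δ′ : ℚ) →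
    IsParamBasis B →
    SortedByDeg B →
    LinIndep (map (λ f → toℚV (pilot f)) B) →
    AsymOrthDegrees B →
    (+ 1 / 4) < δ → δ < δ′ → δ′ < 1ℚ →
    (∀ (d : ℕ) → AsymLovasz δ′ (Bsub B d)) →
    EventualLovasz δ (toList B)
lemma3p20 B δ δ′ _ sorted indep orth _ δ<δ′ δ′<1 asym =
  eventually-map (λ (1≤t , bound) → subst (All (δ ≤_)) (sym (lovVals-evalL L 1≤t)) bound)
    (eventually-∧ (eventually-≥ 1)
      (all-rescaled-eventually-≥ (limits ⊆-refl) sameTag (lovValsFrom-pos [] pilots [] (nonNull ⊆-refl))
        (sorted⇒adjacent-≤ B sorted) δ<δ′ (<-trans δ<δ′ δ′<1)))
  where
  open Blocks deg pilotℚ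
  L = toList B
  pilots = List.map pilotℚ L
  nonNull : ∀ {fs} → fs ⊆ L → NonNullFrom [] (List.map pilotℚ fs)
  nonNull fs⊆L = linIndep⇒nonNullFrom [] [] _ []
    (linIndep-⊆ (⊆.map⁺ pilotℚ fs⊆L) (subst LinIndepList (Vec.toList-map pilotℚ B) (linIndep⇒linIndepList _ indep)))
  limits : ∀ {fs} → fs ⊆ L →
           Pointwise _⟶_ (lovValsFromSeq [] (List.map normalised fs)) (lovValsFrom [] (List.map pilotℚ fs))
  limits {fs} fs⊆L = ⟶-lovValsFrom [] [] (⟶ⱽ-normalised fs) (nonNull fs⊆L)
  blockBounds : BlockBounds δ′ [] L
  blockBounds d = ⟶-nth-≥ _ (limits (⊆.filter-⊆ _ L)) λ i ε ε>0 →
    eventually-map (λ (1≤t , above) q nth≡q → above q (trans (cong (λ ℓs → nth ℓs i)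
                     (lovVals-evalL-block (itemsOf d L) d 1≤t (All.all-filter _ L))) nth≡q))
      (eventually-∧ (eventually-≥ 1) (asym d i ε ε>0))
  sameTag = sameTag-bounds [] L (asymOrth⇒allPairs B orth) (All.universal (λ _ → []) L) blockBounds
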